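{- For $n\geq 2$ and $r\in[n]$, $$\sum_{T\in \mathcal P_{n}^{(r)}}t^{{\rm eld}(T)}\prod_{i=1}^{n}x_i^{{\rm young}_T(i)}=x_r\prod_{k=1}^{n-2}(x_1+\cdots+x_{n}+kt).$$
   Context: A plane tree on a finite totally ordered set is a rooted tree in which the children of each vertex are linearly ordered (left to right). A vertex $j$ is a descendant of $i$ if the path from the root to $j$ passes through $i$ (each vertex is its own descendant); $\beta_T(i)$ is the smallest descendant of $i$. A child $j$ of $v$ is elder if $v$ has a child $k$ to the right of $j$ with $\beta_T(k)<\beta_T(j)$, and younger otherwise. ${\rm young}_T(v)$ is the number of younger children of $v$ and ${\rm eld}(T)$ is the total number of elder vertices of $T$. $\mathcal P_n^{(r)}$ is the set of plane trees on $[n]=\{1,\dots,n\}$ with root $r$. Empty products equal $1$. -}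

module Defs where

open import Data.Nat using (ℕ; zero; suc; _+_; _⊓_; _<?_; _≟_; _∸_)
open import Data.Product using (_×_)
open import Data.List using (List; []; _∷_; _++_; upTo; map)
open import Data.Bool using (Bool; true; false; if_then_else_)
open import Relation.Nullary.Decidable using (does)
open import Algebra.Bundles using (CommutativeSemiring)
open import Data.List.Relation.Binary.Permutation.Propositional using (_↭_)
open import Relation.Binary.PropositionalEquality using (_≡_)

-- A plane tree: a labelled rose tree; the children of a vertex are listed
-- left to right.
data Tree : Set where
  node : ℕ → List Tree → Tree

root : Tree → ℕ
root (node v _) = v

mutual
  labels : Tree → List ℕ
  labels (node v cs) = v ∷ labelsF cs

  labelsF : List Tree → List ℕ
  labelsF [] = []
  labelsF (c ∷ cs) = labels c ++ labelsF cs

mutual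
  β : Tree → ℕ
  β (node v cs) = minF v cs

  minF : ℕ → List Tree → ℕ
  minF m [] = m
  minF m (c ∷ cs) = minF (m ⊓ β c) cs

anySmaller : ℕ → List Tree → Bool
anySmaller b [] = false
anySmaller b (k ∷ ks) = if does (β k <? b) then true else anySmaller b ks

youngCh : List Tree → ℕ
youngCh [] = 0
youngCh (c ∷ cs) = (if anySmaller (β c) cs then 0 else 1) + youngCh cs

elderCh : List Tree → ℕ
elderCh [] = 0
elderCh (c ∷ cs) = (if anySmaller (β c) cs then 1 else 0) + elderCh cs

mutual
  eld : Tree → ℕ
  eld (node v cs) = elderCh cs + eldF cs

  eldF : List Tree → ℕ
  eldF [] = 0
  eldF (c ∷ cs) = eld c + eldF cs

mutual
  young : Tree → ℕ → ℕ
  young (node v cs) i = (if does (v ≟ i) then youngCh cs else 0) + youngF cs i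

  youngF : List Tree → ℕ → ℕ
  youngF [] i = 0
  youngF (c ∷ cs) i = young c i + youngF cs i

-- [n] = {1,…,n}
range : ℕ → List ℕ
range n = map suc (upTo n)

IsPlaneTree : ℕ → ℕ → Tree → Set
IsPlaneTree n r T = (root T ≡ r) × (labels T ↭ range n)

module _ {c ℓ} (R : CommutativeSemiring c ℓ) where
  open CommutativeSemiring R renaming (_+_ to _⊕_; _*_ to _⊗_)
  open import Algebra.Definitions.RawSemiring rawSemiring using (_^_) renaming (_×_ to _·_)

  sumL : List Carrier → Carrier
  sumL [] = 0#
  sumL (a ∷ as) = a ⊕ sumL as

  prodL : List Carrier → Carrier
  prodL [] = 1#
  prodL (a ∷ as) = a ⊗ prodL as

  treeWeight : ℕ → (ℕ → Carrier) → Carrier → Tree → Carrier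
  treeWeight n x t T = (t ^ eld T) ⊗ prodL (map (λ i → x i ^ young T i) (range n))

  rhs : ℕ → ℕ → (ℕ → Carrier) → Carrier → Carrier
  rhs n r x t = x r ⊗ prodL (map (λ k → sumL (map x (range n)) ⊕ (k · t)) (range (n ∸ 2)))

-- Let μ be the smallest vertex other than the root r and
-- p its parent.  Contracting the edge p–μ (μ takes the place of p, and its children become a merge
-- of p's children left of μ, p's children right of μ and μ's own children) is a bijection between
-- the trees on S rooted at r and the triples (p, T′, ω) where T′ is a tree on S ∖ {p} (rooted at μ
-- if p = r, at r otherwise) and ω assigns to each younger child of μ in T′ the list its block came
-- from.  The weight of T is x_p · t^#left · x_p^#right · x_μ^#below times the weight of T′ at
-- x_μ = 1, so summing over ω evaluates T′ at x_μ = t + x_p + x_μ.  There the variables add up to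
-- x_1 + ⋯ + x_n + t, and the induction hypothesis followed by the sum over p gives the product.

module Submission where

open import Defs
open import Data.Nat using (ℕ; _≤_)
open import Data.List using (List; map)
open import Data.List.Membership.Propositional using (_∈_)
open import Data.List.Relation.Unary.Unique.Propositional using (Unique)
open import Function.Bundles using (_⇔_)
open import Algebra.Bundles using (CommutativeSemiring)
open import Level using (_⊔_)

open import Data.Nat using (zero; suc; _+_; _<_; _⊓_; _≟_; _<?_; s≤s; z≤n)
open import Data.Nat.Properties as ℕ
  using ( ≤-refl; ≤-trans; ≤-antisym; <-irrefl; <-≤-trans; ≤-<-trans; <⇒≤; ≤∧≢⇒<; ≮⇒≥
        ; m⊓n≤m; m⊓n≤n; suc-injective)
open import Data.Bool using (Bool; true; false; if_then_else_; _∨_)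
open import Data.Bool.Properties using (∨-zeroʳ; ⇔→≡)
open import Algebra.Properties.CommutativeSemigroup ℕ.+-commutativeSemigroup
  using () renaming (x∙yz≈y∙xz to +-x∙yz≈y∙xz)
open import Data.Empty using (⊥; ⊥-elim)
open import Data.Maybe using (Maybe; just; nothing)
open import Data.Product using (_×_; _,_; proj₁; proj₂; ∃; ∃₂; uncurry)
open import Data.Sum using (_⊎_; inj₁; inj₂)
open import Data.List
  using ([]; _∷_; _++_; [_]; length; concatMap; filter; deduplicate; replicate; upTo)
open import Data.List.Properties
  using (∷-injective; ++-assoc; ++-identityʳ; map-++; map-∘; map-applyUpTo; length-map; length-upTo; length-replicate)
open import Data.List.Membership.Propositional using (_∉_; find; lose)
open import Data.List.Membership.Propositional.Properties
  using ( ∈-++⁺ˡ; ∈-++⁺ʳ; ∈-++⁻; ∈-map⁺; ∈-map⁻; ∈-concatMap⁺; ∈-concatMap⁻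
        ; ∈-map∘filter⁺; ∈-map∘filter⁻; deduplicate-∈⇔; ∈-deduplicate⁻; ∈-upTo⁺)
open import Data.List.Membership.Propositional.Properties.WithK using (unique∧set⇒bag)
open import Data.List.Relation.Unary.Any using (here; there)
open import Data.List.Relation.Unary.All as All using (All; []; _∷_)
import Data.List.Extrema.Nat as Extrema
open import Data.List.Relation.Unary.AllPairs using ([]; _∷_)
open import Data.List.Relation.Unary.Unique.Propositional.Properties as Unique
  using (Unique[x∷xs]⇒x∉xs; upTo⁺)
open import Data.List.Relation.Unary.Unique.DecPropositional.Properties using (deduplicate-!)
open import Data.List.Relation.Binary.BagAndSetEquality using (∼bag⇒↭)
open import Data.List.Relation.Binary.Permutation.Propositional
  using (_↭_; ↭-refl; ↭-sym; ↭-trans; prep; swap; ↭⇒↭ₛ; module PermutationReasoning)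
import Data.List.Relation.Binary.Permutation.Propositional as Perm
open import Data.List.Relation.Binary.Permutation.Propositional.Properties
  using (∈-resp-↭; ↭-length; shift; ++⁺ˡ; drop-∷; ↭-singleton-inv)
  renaming (map⁺ to map⁺-↭; ++-comm to ++-comm-↭; ++⁺ to ++⁺-↭)
import Data.List.Relation.Binary.Permutation.Setoid.Properties as PermSetoid
open import Function.Bundles using (mk⇔; Equivalence)
open import Function.Base using (id)
open import Relation.Binary.PropositionalEquality
  using (_≡_; _≢_; refl; sym; trans; cong; cong₂; subst; setoid; ≢-sym)
open import Relation.Nullary using (Dec; yes; no; does; proof)
open import Relation.Nullary.Reflects using (ofʸ; ofⁿ)

-- Finite sets as duplicate-free lists

Unique-resp-↭ : ∀ {A : Set} {xs ys : List A} → xs ↭ ys → Unique xs → Unique ys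
Unique-resp-↭ p = PermSetoid.Unique-resp-↭ (setoid _) (↭⇒↭ₛ p)

unique∧set⇒↭ : ∀ {A : Set} {xs ys : List A} → Unique xs → Unique ys →
  (∀ {x} → (x ∈ xs) ⇔ (x ∈ ys)) → xs ↭ ys
unique∧set⇒↭ u v eq = ∼bag⇒↭ (unique∧set⇒bag u v eq)

Unique-++⁻ʳ : ∀ {A : Set} (xs : List A) {ys} → Unique (xs ++ ys) → Unique ys
Unique-++⁻ʳ []       u       = u
Unique-++⁻ʳ (x ∷ xs) (_ ∷ u) = Unique-++⁻ʳ xs u

Unique-++⇒disjoint : ∀ {A : Set} (xs : List A) {ys x y} → Unique (xs ++ ys) → x ∈ xs → y ∈ ys → x ≢ y
Unique-++⇒disjoint (z ∷ zs) {ys} u@(_ ∷ _) (here refl) y∈ys refl = Unique[x∷xs]⇒x∉xs u (∈-++⁺ʳ zs y∈ys)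
Unique-++⇒disjoint (z ∷ zs) (_ ∷ u) (there x∈zs) y∈ys = Unique-++⇒disjoint zs u x∈zs y∈ys

Unique-map⁺-injectiveOn : ∀ {A B : Set} (f : A → B) {xs} →
  (∀ {a b} → a ∈ xs → b ∈ xs → f a ≡ f b → a ≡ b) → Unique xs → Unique (map f xs)
Unique-map⁺-injectiveOn f {[]}     inj []      = []
Unique-map⁺-injectiveOn f {x ∷ xs} inj (a ∷ u) =
  distinct xs (λ m → m) ∷ Unique-map⁺-injectiveOn f (λ ma mb → inj (there ma) (there mb)) u
  where
  distinct : ∀ ys → (∀ {y} → y ∈ ys → y ∈ xs) → All (f x ≢_) (map f ys)
  distinct []       _   = []
  distinct (y ∷ ys) sub = fx≢fy ∷ distinct ys (λ m → sub (there m))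
    where
    fx≢fy : f x ≢ f y
    fx≢fy e = Unique[x∷xs]⇒x∉xs (a ∷ u)
      (subst (_∈ xs) (sym (inj (here refl) (there (sub (here refl))) e)) (sub (here refl)))

Unique-concatMap⁺ : ∀ {A B : Set} (f : A → List B) (key : B → A) → (∀ {x b} → b ∈ f x → key b ≡ x) →
  ∀ {xs} → Unique xs → (∀ {x} → x ∈ xs → Unique (f x)) → Unique (concatMap f xs)
Unique-concatMap⁺ f key key-f {[]}     []      _   = []
Unique-concatMap⁺ f key key-f {x ∷ xs} (a ∷ u) ufx =
  Unique.++⁺ (ufx (here refl)) (Unique-concatMap⁺ f key key-f u (λ m → ufx (there m))) disjoint
  where
  disjoint : ∀ {b} → b ∈ f x × b ∈ concatMap f xs → ⊥
  disjoint (b∈fx , b∈rest) with find (∈-concatMap⁻ f b∈rest)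
  ... | y , y∈xs , b∈fy =
    Unique[x∷xs]⇒x∉xs (a ∷ u) (subst (_∈ xs) (trans (sym (key-f b∈fy)) (key-f b∈fx)) y∈xs)

Unique-map⇒injectiveOn : ∀ {A B : Set} (f : A → B) {xs x y} → Unique (map f xs) →
  x ∈ xs → y ∈ xs → f x ≡ f y → x ≡ y
Unique-map⇒injectiveOn f {z ∷ zs} u       (here refl) (here refl) _  = refl
Unique-map⇒injectiveOn f {z ∷ zs} u       (here refl) (there y∈)  fx≡fy =
  ⊥-elim (Unique[x∷xs]⇒x∉xs u (subst (_∈ map f zs) (sym fx≡fy) (∈-map⁺ f y∈)))
Unique-map⇒injectiveOn f {z ∷ zs} u       (there x∈)  (here refl) fx≡fy =
  ⊥-elim (Unique[x∷xs]⇒x∉xs u (subst (_∈ map f zs) fx≡fy (∈-map⁺ f x∈)))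
Unique-map⇒injectiveOn f {z ∷ zs} (_ ∷ u) (there x∈)  (there y∈)  fx≡fy =
  Unique-map⇒injectiveOn f u x∈ y∈ fx≡fy

map-bijection-↭ : ∀ {A B : Set} {P : A → Set} {Q : B → Set} {xs ys} (f : A → B) (g : B → A) →
  (∀ x → (x ∈ xs) ⇔ P x) → (∀ y → (y ∈ ys) ⇔ Q y) → Unique xs → Unique ys →
  (∀ {x} → P x → Q (f x)) → (∀ {y} → Q y → P (g y)) →
  (∀ {x} → P x → g (f x) ≡ x) → (∀ {y} → Q y → f (g y) ≡ y) → map f xs ↭ ys
map-bijection-↭ {P = P} {Q} {xs} {ys} f g xs⇔ ys⇔ xs-unique ys-unique f-Q g-P gf fg =
  unique∧set⇒↭ (Unique-map⁺-injectiveOn f injective xs-unique) ys-unique (mk⇔ to from)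
  where
  P⁻ : ∀ {x} → x ∈ xs → P x
  P⁻ {x} = Equivalence.to (xs⇔ x)
  injective : ∀ {a b} → a ∈ xs → b ∈ xs → f a ≡ f b → a ≡ b
  injective a∈ b∈ fa≡fb = trans (sym (gf (P⁻ a∈))) (trans (cong g fa≡fb) (gf (P⁻ b∈)))
  to : ∀ {y} → y ∈ map f xs → y ∈ ys
  to y∈ with ∈-map⁻ f y∈
  ... | x , x∈ , refl = Equivalence.from (ys⇔ (f x)) (f-Q (P⁻ x∈))
  from : ∀ {y} → y ∈ ys → y ∈ map f xs
  from {y} y∈ = subst (_∈ map f xs) (fg Qy) (∈-map⁺ f (Equivalence.from (xs⇔ (g y)) (g-P Qy)))
    where
    Qy : Q y
    Qy = Equivalence.to (ys⇔ y) y∈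

delete : ℕ → List ℕ → List ℕ
delete p []      = []
delete p (v ∷ S) = if does (v ≟ p) then S else v ∷ delete p S

delete-↭ : ∀ {p} S → p ∈ S → S ↭ p ∷ delete p S
delete-↭ {p} (v ∷ S) p∈ with does (v ≟ p) | proof (v ≟ p) | p∈
... | true  | ofʸ refl | _         = ↭-refl
... | false | ofⁿ v≢p  | here p≡v  = ⊥-elim (v≢p (sym p≡v))
... | false | ofⁿ _    | there p∈S = ↭-trans (prep v (delete-↭ S p∈S)) (swap v p ↭-refl)

module _ {S : List ℕ} {p : ℕ} (p∈S : p ∈ S) where

  ∈-delete⁺ : ∀ {v} → v ∈ S → v ≢ p → v ∈ delete p S
  ∈-delete⁺ v∈S v≢p with ∈-resp-↭ (delete-↭ S p∈S) v∈S
  ... | here v≡p = ⊥-elim (v≢p v≡p)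
  ... | there v∈ = v∈

  ∈-delete⁻ : ∀ {v} → v ∈ delete p S → v ∈ S
  ∈-delete⁻ v∈ = ∈-resp-↭ (↭-sym (delete-↭ S p∈S)) (there v∈)

  Unique-delete⁺ : Unique S → Unique (delete p S)
  Unique-delete⁺ u with Unique-resp-↭ (delete-↭ S p∈S) u
  ... | _ ∷ u′ = u′

  ∈-delete⇒≢ : Unique S → ∀ {v} → v ∈ delete p S → v ≢ p
  ∈-delete⇒≢ u v∈ refl = Unique[x∷xs]⇒x∉xs (Unique-resp-↭ (delete-↭ S p∈S) u) v∈

  length-delete : suc (length (delete p S)) ≡ length S
  length-delete = sym (↭-length (delete-↭ S p∈S))

smallest-non-root : ∀ {S r} m → length S ≡ suc (suc m) → Unique S → r ∈ S →
  ∃ λ μ → μ ∈ S × μ ≢ r × (∀ {v} → v ∈ S → v ≢ r → μ ≤ v)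
smallest-non-root {S} {r} m length≡ S-unique r∈S with delete r S in eq | length-delete r∈S
... | a ∷ as | _ =
  μ , ∈-delete⁻ r∈S μ∈ , ∈-delete⇒≢ r∈S S-unique μ∈ ,
  λ v∈ v≢r → μ≤ (∈-delete⁺ r∈S v∈ v≢r)
  where
  μ : ℕ
  μ = Extrema.min a as
  μ∈ : μ ∈ delete r S
  μ∈ with Extrema.argmin-sel id a as
  ... | inj₁ μ≡a  = subst (μ ∈_) (sym eq) (here μ≡a)
  ... | inj₂ μ∈as = subst (μ ∈_) (sym eq) (there μ∈as)
  μ≤ : ∀ {v} → v ∈ delete r S → μ ≤ v
  μ≤ v∈ with subst (_ ∈_) eq v∈
  ... | here refl  = Extrema.min≤⊤ a as
  ... | there v∈as = All.lookup (Extrema.min≤xs a as) v∈as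
... | [] | length≡′ = ⊥-elim (ℕ.0≢1+n (suc-injective (trans length≡′ length≡)))

range-suc : ∀ n → range (suc n) ≡ 1 ∷ map suc (range n)
range-suc n = cong (1 ∷_) (trans (map-applyUpTo suc suc n)
                                 (sym (trans (cong (map suc) (map-applyUpTo id suc n)) (map-applyUpTo suc suc n))))

range-unique : ∀ n → Unique (range n)
range-unique n = Unique.map⁺ suc-injective (upTo⁺ n)

length-range : ∀ n → length (range n) ≡ n
length-range n = trans (length-map suc (upTo n)) (length-upTo n)

∈-range : ∀ {n r} → 1 ≤ r → r ≤ n → r ∈ range n
∈-range {r = suc r′} (s≤s z≤n) r≤n = ∈-map⁺ suc (∈-upTo⁺ r≤n)

-- Smallest descendants

mutual
  β-∈ : ∀ T → β T ∈ labels T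
  β-∈ (node v cs) with minF-∈ v cs
  ... | inj₁ β≡v  = here β≡v
  ... | inj₂ β∈cs = there β∈cs

  minF-∈ : ∀ m cs → minF m cs ≡ m ⊎ minF m cs ∈ labelsF cs
  minF-∈ m []       = inj₁ refl
  minF-∈ m (c ∷ cs) with minF-∈ (m ⊓ β c) cs | ℕ.⊓-sel m (β c)
  ... | inj₂ ∈cs  | _         = inj₂ (∈-++⁺ʳ (labels c) ∈cs)
  ... | inj₁ ≡m⊓ | inj₁ m⊓≡m = inj₁ (trans ≡m⊓ m⊓≡m)
  ... | inj₁ ≡m⊓ | inj₂ m⊓≡β =
    inj₂ (∈-++⁺ˡ (subst (_∈ labels c) (sym (trans ≡m⊓ m⊓≡β)) (β-∈ c)))

minF-≤ : ∀ m cs → minF m cs ≤ m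
minF-≤ m []       = ≤-refl
minF-≤ m (c ∷ cs) = ≤-trans (minF-≤ (m ⊓ β c) cs) (m⊓n≤m m (β c))

mutual
  β-≤ : ∀ T {v} → v ∈ labels T → β T ≤ v
  β-≤ (node v cs) (here refl) = minF-≤ v cs
  β-≤ (node v cs) (there v∈)  = minF-≤-labelsF v cs v∈

  minF-≤-labelsF : ∀ m cs {v} → v ∈ labelsF cs → minF m cs ≤ v
  minF-≤-labelsF m (c ∷ cs) v∈ with ∈-++⁻ (labels c) v∈
  ... | inj₁ v∈c  = ≤-trans (minF-≤ (m ⊓ β c) cs) (≤-trans (m⊓n≤n m (β c)) (β-≤ c v∈c))
  ... | inj₂ v∈cs = minF-≤-labelsF (m ⊓ β c) cs v∈cs

β-≡ : ∀ T {m} → m ∈ labels T → (∀ {v} → v ∈ labels T → m ≤ v) → β T ≡ m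
β-≡ T m∈ m≤ = ≤-antisym (β-≤ T m∈) (m≤ (β-∈ T))

minF-≤-β : ∀ m cs {y} → y ∈ cs → minF m cs ≤ β y
minF-≤-β m (c ∷ cs) (here refl) = ≤-trans (minF-≤ (m ⊓ β c) cs) (m⊓n≤n m (β c))
minF-≤-β m (c ∷ cs) (there y∈)  = minF-≤-β (m ⊓ β c) cs y∈

minF-sel : ∀ m cs → minF m cs ≡ m ⊎ ∃ λ y → y ∈ cs × minF m cs ≡ β y
minF-sel m []       = inj₁ refl
minF-sel m (c ∷ cs) with minF-sel (m ⊓ β c) cs | ℕ.⊓-sel m (β c)
... | inj₂ (y , y∈ , ≡βy) | _         = inj₂ (y , there y∈ , ≡βy)
... | inj₁ ≡m⊓            | inj₁ m⊓≡m = inj₁ (trans ≡m⊓ m⊓≡m)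
... | inj₁ ≡m⊓            | inj₂ m⊓≡β = inj₂ (c , here refl , trans ≡m⊓ m⊓≡β)

minβ : Tree → List Tree → ℕ
minβ l L = minF (β l) L

minβ-sel : ∀ l L → ∃ λ y → y ∈ l ∷ L × minβ l L ≡ β y
minβ-sel l L with minF-sel (β l) L
... | inj₁ ≡βl            = l , here refl , ≡βl
... | inj₂ (y , y∈ , ≡βy) = y , there y∈ , ≡βy

minβ-≤ : ∀ l L {y} → y ∈ l ∷ L → minβ l L ≤ β y
minβ-≤ l L (here refl) = minF-≤ (β l) L
minβ-≤ l L (there y∈)  = minF-≤-β (β l) L y∈

minβ-minimum : ∀ l L → ∃ λ m → m ∈ l ∷ L × (∀ {y} → y ∈ l ∷ L → β m ≤ β y)
minβ-minimum l L with minβ-sel l L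
... | m , m∈ , ≡βm = m , m∈ , λ y∈ → subst (_≤ _) ≡βm (minβ-≤ l L y∈)

anySmaller-true⁻ : ∀ b xs → anySmaller b xs ≡ true → ∃ λ y → y ∈ xs × β y < b
anySmaller-true⁻ b (k ∷ ks) any with does (β k <? b) | proof (β k <? b)
... | true  | ofʸ βk<b = k , here refl , βk<b
... | false | ofⁿ _    with anySmaller-true⁻ b ks any
...   | y , y∈ , βy<b = y , there y∈ , βy<b

anySmaller-true⁺ : ∀ {b y} xs → y ∈ xs → β y < b → anySmaller b xs ≡ true
anySmaller-true⁺ {b} (k ∷ ks) y∈ βy<b with does (β k <? b) | proof (β k <? b) | y∈
... | true  | _        | _         = refl
... | false | ofⁿ βk≮b | here refl = ⊥-elim (βk≮b βy<b)
... | false | ofⁿ _    | there y∈ks = anySmaller-true⁺ ks y∈ks βy<b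

anySmaller-false⁻ : ∀ {b y} xs → anySmaller b xs ≡ false → y ∈ xs → b ≤ β y
anySmaller-false⁻ {b} (k ∷ ks) none y∈ with does (β k <? b) | proof (β k <? b) | y∈
... | false | ofⁿ βk≮b | here refl  = ≮⇒≥ βk≮b
... | false | ofⁿ _    | there y∈ks = anySmaller-false⁻ ks none y∈ks

anySmaller-false⁺ : ∀ b xs → (∀ {y} → y ∈ xs → b ≤ β y) → anySmaller b xs ≡ false
anySmaller-false⁺ b []       _     = refl
anySmaller-false⁺ b (k ∷ ks) b≤all with does (β k <? b) | proof (β k <? b)
... | true  | ofʸ βk<b = ⊥-elim (<-irrefl refl (<-≤-trans βk<b (b≤all (here refl))))
... | false | ofⁿ _    = anySmaller-false⁺ b ks (λ y∈ → b≤all (there y∈))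

DistinctMinima : List Tree → Set
DistinctMinima xs = Unique (map β xs)

DistinctMinima-↭ : ∀ {xs ys} → xs ↭ ys → DistinctMinima xs → DistinctMinima ys
DistinctMinima-↭ p = Unique-resp-↭ (map⁺-↭ β p)

DistinctMinima-++⇒β≢ : ∀ xs {ys x y} → DistinctMinima (xs ++ ys) → x ∈ xs → y ∈ ys → β x ≢ β y
DistinctMinima-++⇒β≢ xs {ys} u x∈ y∈ =
  Unique-++⇒disjoint (map β xs) (subst Unique (map-++ β xs ys) u) (∈-map⁺ β x∈) (∈-map⁺ β y∈)

DistinctMinima-++⁻ʳ : ∀ xs {ys} → DistinctMinima (xs ++ ys) → DistinctMinima ys
DistinctMinima-++⁻ʳ xs {ys} u = Unique-++⁻ʳ (map β xs) (subst Unique (map-++ β xs ys) u)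

anySmaller-map-β : ∀ b ks ks′ → map β ks ≡ map β ks′ → anySmaller b ks ≡ anySmaller b ks′
anySmaller-map-β b []       []         _ = refl
anySmaller-map-β b (k ∷ ks) (k′ ∷ ks′) e with ∷-injective e
... | βk≡βk′ , rest rewrite βk≡βk′ | anySmaller-map-β b ks ks′ rest = refl

youngCh-map-β : ∀ ks ks′ → map β ks ≡ map β ks′ → youngCh ks ≡ youngCh ks′
youngCh-map-β []       []         _ = refl
youngCh-map-β (k ∷ ks) (k′ ∷ ks′) e with ∷-injective e
... | βk≡βk′ , rest
  rewrite βk≡βk′ | anySmaller-map-β (β k′) ks ks′ rest | youngCh-map-β ks ks′ rest = refl

elderCh-map-β : ∀ ks ks′ → map β ks ≡ map β ks′ → elderCh ks ≡ elderCh ks′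
elderCh-map-β []       []         _ = refl
elderCh-map-β (k ∷ ks) (k′ ∷ ks′) e with ∷-injective e
... | βk≡βk′ , rest
  rewrite βk≡βk′ | anySmaller-map-β (β k′) ks ks′ rest | elderCh-map-β ks ks′ rest = refl

minF-map-β : ∀ m ks ks′ → map β ks ≡ map β ks′ → minF m ks ≡ minF m ks′
minF-map-β m []       []         _ = refl
minF-map-β m (k ∷ ks) (k′ ∷ ks′) e with ∷-injective e
... | βk≡βk′ , rest rewrite βk≡βk′ = minF-map-β (m ⊓ β k′) ks ks′ rest

map-β-replace : ∀ ls rs s s′ → β s ≡ β s′ → map β (ls ++ s ∷ rs) ≡ map β (ls ++ s′ ∷ rs)
map-β-replace ls rs s s′ βs≡βs′
  rewrite map-++ β ls (s ∷ rs) | map-++ β ls (s′ ∷ rs) | βs≡βs′ = refl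

-- Merging three lists of children

-- Where a child of the contracted vertex μ comes from: a sibling left or right of μ, or a child of μ.
data Origin : Set where
  left right below : Origin

_≟ᵒ_ : (g h : Origin) → Dec (g ≡ h)
left  ≟ᵒ left  = yes refl
right ≟ᵒ right = yes refl
below ≟ᵒ below = yes refl
left  ≟ᵒ right = no λ ()
left  ≟ᵒ below = no λ ()
right ≟ᵒ left  = no λ ()
right ≟ᵒ below = no λ ()
below ≟ᵒ left  = no λ ()
below ≟ᵒ right = no λ ()

Parts : Set
Parts = List Tree × List Tree × List Tree

part : Origin → Parts → List Tree
part left  (L , R , D) = L
part right (L , R , D) = R
part below (L , R , D) = D

push : Origin → Tree → Parts → Parts
push left  c (L , R , D) = c ∷ L , R , D
push right c (L , R , D) = L , c ∷ R , D
push below c (L , R , D) = L , R , c ∷ D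

joined : Parts → List Tree
joined (L , R , D) = L ++ R ++ D

-- The default is junk: it is never consulted when there is one origin per younger child.
head₀ : List Origin → Origin
head₀ []      = left
head₀ (g ∷ _) = g

tail₀ : List Origin → List Origin
tail₀ []       = []
tail₀ (_ ∷ gs) = gs

-- Cut the list after each younger child; the k-th block goes to the part named by the k-th origin.
unmerge : List Tree → List Origin → Parts
unmerge []      gs = [] , [] , []
unmerge (c ∷ E) gs =
  if anySmaller (β c) E then push (head₀ gs) c (unmerge E gs) else push (head₀ gs) c (unmerge E (tail₀ gs))

emit : Tree → Origin → Bool → List Tree × List Origin → List Tree × List Origin
emit c g elder (E , gs) = c ∷ E , (if elder then gs else g ∷ gs)

-- Emit the head of the part holding the smallest β, recording its origin when it is younger in its part.
mutual
  merge : List Tree → List Tree → List Tree → List Tree × List Origin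
  merge []      R D = mergeRight [] R D
  merge (l ∷ L) R D = mergeLeftIf (anySmaller (minβ l L) R ∨ anySmaller (minβ l L) D) l L R D

  mergeLeftIf : Bool → Tree → List Tree → List Tree → List Tree → List Tree × List Origin
  mergeLeftIf false l L R D = emit l left (anySmaller (β l) L) (merge L R D)
  mergeLeftIf true  l L R D = mergeRight (l ∷ L) R D

  mergeRight : List Tree → List Tree → List Tree → List Tree × List Origin
  mergeRight L []      D = mergeBelow L [] D
  mergeRight L (r ∷ R) D = mergeRightIf (anySmaller (minβ r R) D) L r R D

  mergeRightIf : Bool → List Tree → Tree → List Tree → List Tree → List Tree × List Origin
  mergeRightIf false L r R D = emit r right (anySmaller (β r) R) (merge L R D)
  mergeRightIf true  L r R D = mergeBelow L (r ∷ R) D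

  mergeBelow : List Tree → List Tree → List Tree → List Tree × List Origin
  mergeBelow L R []      = [] , []
  mergeBelow L R (d ∷ D) = emit d below (anySmaller (β d) D) (merge L R D)

mergeParts : Parts → List Tree × List Origin
mergeParts (L , R , D) = merge L R D

part-⊆-joined : ∀ g P {y} → y ∈ part g P → y ∈ joined P
part-⊆-joined left  (L , R , D) y∈ = ∈-++⁺ˡ y∈
part-⊆-joined right (L , R , D) y∈ = ∈-++⁺ʳ L (∈-++⁺ˡ y∈)
part-⊆-joined below (L , R , D) y∈ = ∈-++⁺ʳ L (∈-++⁺ʳ R y∈)

joined-⊆-part : ∀ P {y} → y ∈ joined P → ∃ λ g → y ∈ part g P
joined-⊆-part (L , R , D) y∈ with ∈-++⁻ L y∈
... | inj₁ y∈L  = left , y∈L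
... | inj₂ y∈RD with ∈-++⁻ R y∈RD
...   | inj₁ y∈R = right , y∈R
...   | inj₂ y∈D = below , y∈D

β≢-across-parts : ∀ P {g h x y} → DistinctMinima (joined P) →
  x ∈ part g P → y ∈ part h P → g ≢ h → β x ≢ β y
β≢-across-parts (L , R , D) {left}  {left}  u x∈ y∈ g≢h = ⊥-elim (g≢h refl)
β≢-across-parts (L , R , D) {left}  {right} u x∈ y∈ g≢h = DistinctMinima-++⇒β≢ L u x∈ (∈-++⁺ˡ y∈)
β≢-across-parts (L , R , D) {left}  {below} u x∈ y∈ g≢h = DistinctMinima-++⇒β≢ L u x∈ (∈-++⁺ʳ R y∈)
β≢-across-parts (L , R , D) {right} {right} u x∈ y∈ g≢h = ⊥-elim (g≢h refl)
β≢-across-parts (L , R , D) {right} {below} u x∈ y∈ g≢h =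
  DistinctMinima-++⇒β≢ R (DistinctMinima-++⁻ʳ L u) x∈ y∈
β≢-across-parts (L , R , D) {below} {below} u x∈ y∈ g≢h = ⊥-elim (g≢h refl)
β≢-across-parts P           {right} {left}  u x∈ y∈ g≢h = ≢-sym (β≢-across-parts P u y∈ x∈ (≢-sym g≢h))
β≢-across-parts P           {below} {left}  u x∈ y∈ g≢h = ≢-sym (β≢-across-parts P u y∈ x∈ (≢-sym g≢h))
β≢-across-parts P           {below} {right} u x∈ y∈ g≢h = ≢-sym (β≢-across-parts P u y∈ x∈ (≢-sym g≢h))

part-unique : ∀ P {g h x} → DistinctMinima (joined P) → x ∈ part g P → x ∈ part h P → g ≡ h
part-unique P {g} {h} u x∈g x∈h with g ≟ᵒ h
... | yes g≡h = g≡h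
... | no  g≢h = ⊥-elim (β≢-across-parts P u x∈g x∈h g≢h refl)

joined-push : ∀ g c P → joined (push g c P) ↭ c ∷ joined P
joined-push left  c (L , R , D) = ↭-refl
joined-push right c (L , R , D) = shift c L (R ++ D)
joined-push below c (L , R , D) = ↭-trans (++⁺ˡ L (shift c R D)) (shift c L (R ++ D))

part-push : ∀ g c P → part g (push g c P) ≡ c ∷ part g P
part-push left  c (L , R , D) = refl
part-push right c (L , R , D) = refl
part-push below c (L , R , D) = refl

part-push-other : ∀ g h c P → g ≢ h → part g (push h c P) ≡ part g P
part-push-other left  right c P _ = refl
part-push-other left  below c P _ = refl
part-push-other right left  c P _ = refl
part-push-other right below c P _ = refl
part-push-other below left  c P _ = refl
part-push-other below right c P _ = refl
part-push-other left  left  c P g≢h = ⊥-elim (g≢h refl)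
part-push-other right right c P g≢h = ⊥-elim (g≢h refl)
part-push-other below below c P g≢h = ⊥-elim (g≢h refl)

part-⊆-push : ∀ g h c P {y} → y ∈ part h P → y ∈ part h (push g c P)
part-⊆-push g h c P y∈ with h ≟ᵒ g
... | yes refl = subst (_ ∈_) (sym (part-push h c P)) (there y∈)
... | no  h≢g  = subst (_ ∈_) (sym (part-push-other h g c P h≢g)) y∈

unmerge-↭ : ∀ E gs → joined (unmerge E gs) ↭ E
unmerge-↭ []      gs = ↭-refl
unmerge-↭ (c ∷ E) gs with anySmaller (β c) E
... | true  = ↭-trans (joined-push (head₀ gs) c (unmerge E gs)) (prep c (unmerge-↭ E gs))
... | false = ↭-trans (joined-push (head₀ gs) c (unmerge E (tail₀ gs))) (prep c (unmerge-↭ E (tail₀ gs)))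

IsMinimum : Tree → List Tree → Set
IsMinimum m xs = m ∈ xs × (∀ {y} → y ∈ xs → β m ≤ β y)

-- The smallest child is younger, so it ends the first block.
unmerge-minimum : ∀ E gs {m} → DistinctMinima E → IsMinimum m E → m ∈ part (head₀ gs) (unmerge E gs)
unmerge-minimum (c ∷ E) gs {m} u (m∈ , m≤) with anySmaller (β c) E in eq | m∈
... | true  | here refl with anySmaller-true⁻ (β c) E eq
...   | y , y∈ , βy<βc = ⊥-elim (<-irrefl refl (<-≤-trans βy<βc (m≤ (there y∈))))
unmerge-minimum (c ∷ E) gs {m} (_ ∷ u) (m∈ , m≤) | true | there m∈E =
  part-⊆-push (head₀ gs) (head₀ gs) c (unmerge E gs) (unmerge-minimum E gs u (m∈E , λ y∈ → m≤ (there y∈)))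
unmerge-minimum (c ∷ E) gs {m} u (m∈ , m≤) | false | here refl =
  subst (m ∈_) (sym (part-push (head₀ gs) m (unmerge E (tail₀ gs)))) (here refl)
unmerge-minimum (c ∷ E) gs {m} u (m∈ , m≤) | false | there m∈E =
  ⊥-elim (Unique[x∷xs]⇒x∉xs u
    (subst (_∈ map β E) (≤-antisym (m≤ (here refl)) (anySmaller-false⁻ E eq m∈E)) (∈-map⁺ β m∈E)))

β<-across-parts : ∀ P {g h m w} → DistinctMinima (joined P) → m ∈ part g P → w ∈ part h P →
  (∀ {y} → y ∈ joined P → β m ≤ β y) → g ≢ h → β m < β w
β<-across-parts P {h = h} u m∈ w∈ m≤ g≢h =
  ≤∧≢⇒< (m≤ (part-⊆-joined h P w∈)) (β≢-across-parts P u m∈ w∈ g≢h)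

minβ-anySmaller-false : ∀ c X Y {m} → m ∈ c ∷ X → (∀ {y} → y ∈ Y → β m ≤ β y) →
  anySmaller (minβ c X) Y ≡ false
minβ-anySmaller-false c X Y m∈ m≤ =
  anySmaller-false⁺ (minβ c X) Y (λ y∈ → ≤-trans (minβ-≤ c X m∈) (m≤ y∈))

minβ-anySmaller-true : ∀ l L Y {m} → m ∈ Y → (∀ {w} → w ∈ l ∷ L → β m < β w) →
  anySmaller (minβ l L) Y ≡ true
minβ-anySmaller-true l L Y m∈ m< with minβ-sel l L
... | w , w∈ , ≡βw = anySmaller-true⁺ Y m∈ (subst (_ <_) (sym ≡βw) (m< w∈))

merge-push : ∀ g c P {m} → m ∈ c ∷ part g P → (∀ {y} → y ∈ joined (push g c P) → β m ≤ β y) →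
  DistinctMinima (joined (push g c P)) →
  mergeParts (push g c P) ≡ emit c g (anySmaller (β c) (part g P)) (mergeParts P)
merge-push left c (L , R , D) m∈ m≤ u
  rewrite minβ-anySmaller-false c L R m∈ (λ y∈ → m≤ (there (∈-++⁺ʳ L (∈-++⁺ˡ y∈))))
        | minβ-anySmaller-false c L D m∈ (λ y∈ → m≤ (there (∈-++⁺ʳ L (∈-++⁺ʳ R y∈)))) = refl
merge-push right c ([] , R , D) m∈ m≤ u
  rewrite minβ-anySmaller-false c R D m∈ (λ y∈ → m≤ (∈-++⁺ʳ (c ∷ R) y∈)) = refl
merge-push right c (l ∷ L , R , D) m∈ m≤ u
  rewrite minβ-anySmaller-true l L (c ∷ R) m∈
            (λ w∈ → β<-across-parts (l ∷ L , c ∷ R , D) {right} {left} u m∈ w∈ m≤ λ ())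
        | minβ-anySmaller-false c R D m∈ (λ y∈ → m≤ (∈-++⁺ʳ (l ∷ L) (∈-++⁺ʳ (c ∷ R) y∈))) = refl
merge-push below c ([] , [] , D) m∈ m≤ u = refl
merge-push below c ([] , r ∷ R , D) m∈ m≤ u
  rewrite minβ-anySmaller-true r R (c ∷ D) m∈
            (λ w∈ → β<-across-parts ([] , r ∷ R , c ∷ D) {below} {right} u m∈ w∈ m≤ λ ()) = refl
merge-push below c (l ∷ L , R , D) m∈ m≤ u
  rewrite minβ-anySmaller-true l L (c ∷ D) m∈
            (λ w∈ → β<-across-parts (l ∷ L , R , c ∷ D) {below} {left} u m∈ w∈ m≤ λ ())
        | ∨-zeroʳ (anySmaller (minβ l L) R) with R
... | []     = refl
... | r ∷ R′
  rewrite minβ-anySmaller-true r R′ (c ∷ D) m∈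
            (λ w∈ → β<-across-parts (l ∷ L , r ∷ R′ , c ∷ D) {below} {right} u m∈ w∈ m≤ λ ()) = refl

anySmaller-unmerge-true : ∀ c E gs → DistinctMinima E → anySmaller (β c) E ≡ true →
  anySmaller (β c) (part (head₀ gs) (unmerge E gs)) ≡ true
anySmaller-unmerge-true c (e ∷ E) gs u any with anySmaller-true⁻ (β c) (e ∷ E) any | minβ-minimum e E
... | y , y∈ , βy<βc | m , m∈ , m≤ =
  anySmaller-true⁺ (part (head₀ gs) (unmerge (e ∷ E) gs)) (unmerge-minimum (e ∷ E) gs u (m∈ , m≤))
    (≤-<-trans (m≤ y∈) βy<βc)

anySmaller-unmerge-false : ∀ c E g gs → anySmaller (β c) E ≡ false →
  anySmaller (β c) (part g (unmerge E gs)) ≡ false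
anySmaller-unmerge-false c E g gs none =
  anySmaller-false⁺ (β c) (part g (unmerge E gs))
    (λ y∈ → anySmaller-false⁻ E none (∈-resp-↭ (unmerge-↭ E gs) (part-⊆-joined g (unmerge E gs) y∈)))

merge-push-unmerge : ∀ g c E gs {m} → DistinctMinima (c ∷ E) → IsMinimum m (c ∷ E) →
  m ∈ c ∷ part g (unmerge E gs) →
  mergeParts (push g c (unmerge E gs)) ≡ emit c g (anySmaller (β c) (part g (unmerge E gs))) (mergeParts (unmerge E gs))
merge-push-unmerge g c E gs u (_ , m≤) m∈ =
  merge-push g c (unmerge E gs) m∈ (λ y∈ → m≤ (∈-resp-↭ c∷E y∈)) (DistinctMinima-↭ (↭-sym c∷E) u)
  where
  c∷E : joined (push g c (unmerge E gs)) ↭ c ∷ E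
  c∷E = ↭-trans (joined-push g c (unmerge E gs)) (prep c (unmerge-↭ E gs))

merge-unmerge : ∀ E gs → DistinctMinima E → length gs ≡ youngCh E → mergeParts (unmerge E gs) ≡ (E , gs)
merge-unmerge []      []  u        l = refl
merge-unmerge (c ∷ E) gs  u@(_ ∷ u′) l with anySmaller (β c) E in eq | minβ-minimum c E
... | true | m , here refl , m≤ with anySmaller-true⁻ (β c) E eq
...   | y , y∈ , βy<βc = ⊥-elim (<-irrefl refl (<-≤-trans βy<βc (m≤ (there y∈))))
merge-unmerge (c ∷ E) gs u@(_ ∷ u′) l | true | m , there m∈E , m≤ =
  trans (merge-push-unmerge (head₀ gs) c E gs u (there m∈E , m≤)
           (there (unmerge-minimum E gs u′ (m∈E , λ y∈ → m≤ (there y∈)))))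
        (cong₂ (emit c (head₀ gs)) (anySmaller-unmerge-true c E gs u′ eq) (merge-unmerge E gs u′ l))
merge-unmerge (c ∷ E) (g ∷ gs) u@(_ ∷ u′) l | false | _ =
  trans (merge-push-unmerge g c E gs u (here refl , c≤) (here refl))
        (cong₂ (emit c g) (anySmaller-unmerge-false c E g gs eq) (merge-unmerge E gs u′ (suc-injective l)))
  where
  c≤ : ∀ {y} → y ∈ c ∷ E → β c ≤ β y
  c≤ (here refl) = ≤-refl
  c≤ (there y∈)  = anySmaller-false⁻ E eq y∈

record MergeOf (P : Parts) (E : List Tree) (gs : List Origin) : Set where
  field
    unmerge≡ : unmerge E gs ≡ P
    length≡  : length gs ≡ youngCh E
    head≡    : ∀ {h w} → w ∈ part h P → (∀ {y} → y ∈ joined P → β w ≤ β y) → head₀ gs ≡ h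

emit-MergeOf : ∀ g c P E gs b → anySmaller (β c) E ≡ b → MergeOf P E gs → (b ≡ true → head₀ gs ≡ g) →
  (∀ {h w} → w ∈ part h (push g c P) → (∀ {y} → y ∈ joined (push g c P) → β w ≤ β y) → g ≡ h) →
  MergeOf (push g c P) (c ∷ E) (if b then gs else g ∷ gs)
emit-MergeOf g c P E gs true elder M head≡g g≡min =
  record { unmerge≡ = unmerge≡′ ; length≡ = length≡′
         ; head≡ = λ w∈ w≤ → trans (head≡g refl) (g≡min w∈ w≤) }
  where
  unmerge≡′ : unmerge (c ∷ E) gs ≡ push g c P
  unmerge≡′ rewrite elder | head≡g refl = cong (push g c) (MergeOf.unmerge≡ M)
  length≡′ : length gs ≡ youngCh (c ∷ E)
  length≡′ rewrite elder = MergeOf.length≡ M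
emit-MergeOf g c P E gs false younger M _ g≡min =
  record { unmerge≡ = unmerge≡′ ; length≡ = length≡′ ; head≡ = g≡min }
  where
  unmerge≡′ : unmerge (c ∷ E) (g ∷ gs) ≡ push g c P
  unmerge≡′ rewrite younger = cong (push g c) (MergeOf.unmerge≡ M)
  length≡′ : suc (length gs) ≡ youngCh (c ∷ E)
  length≡′ rewrite younger = cong suc (MergeOf.length≡ M)

minimum-part : ∀ g c P {m h w} → DistinctMinima (joined (push g c P)) →
  m ∈ c ∷ part g P → (∀ {y} → y ∈ joined (push g c P) → β m ≤ β y) →
  w ∈ part h (push g c P) → (∀ {y} → y ∈ joined (push g c P) → β w ≤ β y) → g ≡ h
minimum-part g c P {m} {h} {w} u m∈ m≤ w∈ w≤ =
  part-unique (push g c P) u m∈g (subst (λ z → z ∈ part h (push g c P)) (sym m≡w) w∈)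
  where
  m∈g : m ∈ part g (push g c P)
  m∈g = subst (m ∈_) (sym (part-push g c P)) m∈
  m≡w : m ≡ w
  m≡w = Unique-map⇒injectiveOn β u (part-⊆-joined g (push g c P) m∈g) (part-⊆-joined h (push g c P) w∈)
          (≤-antisym (m≤ (part-⊆-joined h (push g c P) w∈)) (w≤ (part-⊆-joined g (push g c P) m∈g)))

merge-push-MergeOf : ∀ g c P {m} E gs → mergeParts P ≡ (E , gs) → MergeOf P E gs →
  m ∈ c ∷ part g P → (∀ {y} → y ∈ joined (push g c P) → β m ≤ β y) →
  DistinctMinima (joined (push g c P)) →
  uncurry (MergeOf (push g c P)) (mergeParts (push g c P))
merge-push-MergeOf g c P {m} E gs merge≡ M m∈ m≤ u =
  subst (uncurry (MergeOf (push g c P)))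
        (sym (trans (merge-push g c P m∈ m≤ u) (cong (emit c g (anySmaller (β c) (part g P))) merge≡)))
        (emit-MergeOf g c P E gs _ same-answer M head≡g (minimum-part g c P u m∈ m≤))
  where
  E↭P : E ↭ joined P
  E↭P = ↭-sym (subst (λ z → joined z ↭ E) (MergeOf.unmerge≡ M) (unmerge-↭ E gs))
  ⊆push : ∀ {y} → y ∈ joined P → y ∈ joined (push g c P)
  ⊆push y∈ = ∈-resp-↭ (↭-sym (joined-push g c P)) (there y∈)
  m∈part : ∀ {y} → y ∈ joined P → β y < β c → m ∈ part g P
  m∈part = in-tail m∈
    where
    in-tail : ∀ {y} → m ∈ c ∷ part g P → y ∈ joined P → β y < β c → m ∈ part g P
    in-tail (here refl) y∈ βy<βc = ⊥-elim (<-irrefl refl (<-≤-trans βy<βc (m≤ (⊆push y∈))))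
    in-tail (there m∈g) _  _     = m∈g
  same-answer : anySmaller (β c) E ≡ anySmaller (β c) (part g P)
  same-answer = ⇔→≡ {z = true} (mk⇔ to from)
    where
    to : anySmaller (β c) E ≡ true → anySmaller (β c) (part g P) ≡ true
    to any with anySmaller-true⁻ (β c) E any
    ... | y , y∈ , βy<βc = anySmaller-true⁺ (part g P) (m∈part (∈-resp-↭ E↭P y∈) βy<βc)
                             (≤-<-trans (m≤ (⊆push (∈-resp-↭ E↭P y∈))) βy<βc)
    from : anySmaller (β c) (part g P) ≡ true → anySmaller (β c) E ≡ true
    from any with anySmaller-true⁻ (β c) (part g P) any
    ... | y , y∈ , βy<βc = anySmaller-true⁺ E (∈-resp-↭ (↭-sym E↭P) (part-⊆-joined g P y∈)) βy<βc
  head≡g : anySmaller (β c) (part g P) ≡ true → head₀ gs ≡ g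
  head≡g any with anySmaller-true⁻ (β c) (part g P) any
  ... | y , y∈ , βy<βc =
    MergeOf.head≡ M (m∈part (part-⊆-joined g P y∈) βy<βc) (λ y∈ → m≤ (⊆push y∈))

nonempty-minimum : ∀ xs {n} → length xs ≡ suc n → ∃ λ m → IsMinimum m xs
nonempty-minimum (x ∷ xs) _ = minβ-minimum x xs

split-at-part : ∀ g P {m} → m ∈ part g P → ∃₂ λ c P′ → P ≡ push g c P′ × m ∈ c ∷ part g P′
split-at-part left  (c ∷ L , R , D) m∈ = c , (L , R , D) , refl , m∈
split-at-part right (L , c ∷ R , D) m∈ = c , (L , R , D) , refl , m∈
split-at-part below (L , R , c ∷ D) m∈ = c , (L , R , D) , refl , m∈

mergeParts-MergeOf : ∀ n P → length (joined P) ≡ n → DistinctMinima (joined P) → uncurry (MergeOf P) (mergeParts P)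
mergeParts-MergeOf zero ([] , [] , []) _ _ =
  record { unmerge≡ = refl ; length≡ = refl ; head≡ = λ {h} w∈ _ → ⊥-elim (nothing-in h w∈) }
  where
  nothing-in : ∀ h {w} → w ∉ part h ([] , [] , [])
  nothing-in left  ()
  nothing-in right ()
  nothing-in below ()
mergeParts-MergeOf (suc n) P l u with nonempty-minimum (joined P) l
... | m , m∈ , m≤ with joined-⊆-part P m∈
...   | g , m∈g with split-at-part g P m∈g
...     | c , P′ , refl , m∈′ =
  merge-push-MergeOf g c P′ _ _ refl (mergeParts-MergeOf n P′ l′ u′) m∈′ m≤ u
  where
  l′ : length (joined P′) ≡ n
  l′ = suc-injective (trans (sym (↭-length (joined-push g c P′))) l)
  u′ : DistinctMinima (joined P′)
  u′ with DistinctMinima-↭ (joined-push g c P′) u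
  ... | _ ∷ u′ = u′

count : Origin → List Origin → ℕ
count g []       = 0
count g (h ∷ gs) = if does (g ≟ᵒ h) then suc (count g gs) else count g gs

count-same : ∀ g gs → count g (g ∷ gs) ≡ suc (count g gs)
count-same g gs with g ≟ᵒ g
... | yes _   = refl
... | no g≢g = ⊥-elim (g≢g refl)

count-other : ∀ g h gs → g ≢ h → count g (h ∷ gs) ≡ count g gs
count-other g h gs g≢h with g ≟ᵒ h
... | yes g≡h = ⊥-elim (g≢h g≡h)
... | no _    = refl

elderParts : Parts → ℕ
elderParts (L , R , D) = elderCh L + (elderCh R + elderCh D)

youngCh-push : ∀ g c P →
  youngCh (part g (push g c P)) ≡ (if anySmaller (β c) (part g P) then 0 else 1) + youngCh (part g P)
youngCh-push g c P rewrite part-push g c P = refl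

elderParts-push : ∀ g c P → elderParts (push g c P) ≡ (if anySmaller (β c) (part g P) then 1 else 0) + elderParts P
elderParts-push left  c (L , R , D) = ℕ.+-assoc (if anySmaller (β c) L then 1 else 0) _ _
elderParts-push right c (L , R , D) =
  trans (cong (elderCh L +_) (ℕ.+-assoc e (elderCh R) (elderCh D))) (+-x∙yz≈y∙xz (elderCh L) e _)
  where
  e : ℕ
  e = if anySmaller (β c) R then 1 else 0
elderParts-push below c (L , R , D) =
  trans (cong (elderCh L +_) (+-x∙yz≈y∙xz (elderCh R) e (elderCh D))) (+-x∙yz≈y∙xz (elderCh L) e _)
  where
  e : ℕ
  e = if anySmaller (β c) D then 1 else 0

unmerge-youngCh : ∀ E gs → DistinctMinima E → length gs ≡ youngCh E →
  ∀ g → youngCh (part g (unmerge E gs)) ≡ count g gs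
unmerge-youngCh []      []       _          _ g = empty-part g
  where
  empty-part : ∀ g → youngCh (part g ([] , [] , [])) ≡ 0
  empty-part left  = refl
  empty-part right = refl
  empty-part below = refl
unmerge-youngCh (c ∷ E) gs (_ ∷ u′) l g with anySmaller (β c) E in elder | g ≟ᵒ head₀ gs
... | true | yes refl =
  trans (youngCh-push g c (unmerge E gs))
        (trans (cong (λ b → (if b then 0 else 1) + _) (anySmaller-unmerge-true c E gs u′ elder))
               (unmerge-youngCh E gs u′ l g))
... | true | no g≢h =
  trans (cong youngCh (part-push-other g (head₀ gs) c (unmerge E gs) g≢h)) (unmerge-youngCh E gs u′ l g)
unmerge-youngCh (c ∷ E) (h ∷ gs) (_ ∷ u′) l g | false | yes refl =
  trans (youngCh-push g c (unmerge E gs))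
        (trans (cong (λ b → (if b then 0 else 1) + _) (anySmaller-unmerge-false c E g gs elder))
               (trans (cong suc (unmerge-youngCh E gs u′ (suc-injective l) g)) (sym (count-same g gs))))
unmerge-youngCh (c ∷ E) (h ∷ gs) (_ ∷ u′) l g | false | no g≢h =
  trans (cong youngCh (part-push-other g h c (unmerge E gs) g≢h))
        (trans (unmerge-youngCh E gs u′ (suc-injective l) g) (sym (count-other g h gs g≢h)))

unmerge-elderCh : ∀ E gs → DistinctMinima E → length gs ≡ youngCh E → elderParts (unmerge E gs) ≡ elderCh E
unmerge-elderCh []      []       _          _ = refl
unmerge-elderCh (c ∷ E) gs (_ ∷ u′) l with anySmaller (β c) E in elder
... | true =
  trans (elderParts-push (head₀ gs) c (unmerge E gs))
        (trans (cong (λ b → (if b then 1 else 0) + _) (anySmaller-unmerge-true c E gs u′ elder))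
               (cong suc (unmerge-elderCh E gs u′ l)))
unmerge-elderCh (c ∷ E) (h ∷ gs) (_ ∷ u′) l | false =
  trans (elderParts-push h c (unmerge E gs))
        (trans (cong (λ b → (if b then 1 else 0) + _) (anySmaller-unmerge-false c E h gs elder))
               (unmerge-elderCh E gs u′ (suc-injective l)))

length≡youngCh+elderCh : ∀ cs → length cs ≡ youngCh cs + elderCh cs
length≡youngCh+elderCh []       = refl
length≡youngCh+elderCh (c ∷ cs) with anySmaller (β c) cs
... | true  = trans (cong suc (length≡youngCh+elderCh cs)) (sym (ℕ.+-suc (youngCh cs) (elderCh cs)))
... | false = cong suc (length≡youngCh+elderCh cs)

origins : List Origin
origins = left ∷ right ∷ below ∷ []

words : ℕ → List (List Origin)
words zero    = [ [] ]
words (suc k) = concatMap (λ g → map (g ∷_) (words k)) origins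

∈-words⁻ : ∀ k {gs} → gs ∈ words k → length gs ≡ k
∈-words⁻ zero    (here refl) = refl
∈-words⁻ (suc k) gs∈ with find (∈-concatMap⁻ (λ g → map (g ∷_) (words k)) {xs = origins} gs∈)
... | g , _ , gs∈g with ∈-map⁻ (g ∷_) gs∈g
...   | hs , hs∈ , refl = cong suc (∈-words⁻ k hs∈)

∈-words⁺ : ∀ gs → gs ∈ words (length gs)
∈-words⁺ []       = here refl
∈-words⁺ (g ∷ gs) =
  ∈-concatMap⁺ (λ h → map (h ∷_) (words (length gs))) (lose (g∈origins g) (∈-map⁺ (g ∷_) (∈-words⁺ gs)))
  where
  g∈origins : ∀ g → g ∈ origins
  g∈origins left  = here refl
  g∈origins right = there (here refl)
  g∈origins below = there (there (here refl))

words-unique : ∀ k → Unique (words k)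
words-unique zero    = [] ∷ []
words-unique (suc k) =
  Unique-concatMap⁺ (λ g → map (g ∷_) (words k)) head₀ head≡ origins-unique
    (λ _ → Unique.map⁺ (λ { refl → refl }) (words-unique k))
  where
  head≡ : ∀ {g gs} → gs ∈ map (g ∷_) (words k) → head₀ gs ≡ g
  head≡ {g} gs∈ with ∈-map⁻ (g ∷_) gs∈
  ... | _ , _ , refl = refl
  origins-unique : Unique origins
  origins-unique = ((λ ()) ∷ (λ ()) ∷ []) ∷ ((λ ()) ∷ []) ∷ [] ∷ []

mutual
  _≟ᵗ_ : (T U : Tree) → Dec (T ≡ U)
  node v cs ≟ᵗ node w ds with v ≟ w | cs ≟ᶠ ds
  ... | yes refl | yes refl = yes refl
  ... | no v≢w   | _        = no λ { refl → v≢w refl }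
  ... | yes _    | no cs≢ds = no λ { refl → cs≢ds refl }

  _≟ᶠ_ : (cs ds : List Tree) → Dec (cs ≡ ds)
  []       ≟ᶠ []       = yes refl
  []       ≟ᶠ (_ ∷ _)  = no λ ()
  (_ ∷ _)  ≟ᶠ []       = no λ ()
  (c ∷ cs) ≟ᶠ (d ∷ ds) with c ≟ᵗ d | cs ≟ᶠ ds
  ... | yes refl | yes refl = yes refl
  ... | no c≢d   | _        = no λ { refl → c≢d refl }
  ... | yes _    | no cs≢ds = no λ { refl → cs≢ds refl }

-- Trees with a hole

labelsF-++ : ∀ xs ys → labelsF (xs ++ ys) ≡ labelsF xs ++ labelsF ys
labelsF-++ []       ys = refl
labelsF-++ (x ∷ xs) ys rewrite labelsF-++ xs ys = sym (++-assoc (labels x) (labelsF xs) (labelsF ys))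

labelsF-↭ : ∀ {xs ys} → xs ↭ ys → labelsF xs ↭ labelsF ys
labelsF-↭ Perm.refl        = ↭-refl
labelsF-↭ (prep x p)       = ++⁺ˡ (labels x) (labelsF-↭ p)
labelsF-↭ {x ∷ y ∷ xs} {.y ∷ .x ∷ ys} (swap .x .y p) = begin
  labels x ++ labels y ++ labelsF xs   ≡⟨ sym (++-assoc (labels x) _ _) ⟩
  (labels x ++ labels y) ++ labelsF xs ↭⟨ ++⁺-↭ (++-comm-↭ (labels x) (labels y)) (labelsF-↭ p) ⟩
  (labels y ++ labels x) ++ labelsF ys ≡⟨ ++-assoc (labels y) _ _ ⟩
  labels y ++ labels x ++ labelsF ys   ∎
  where open PermutationReasoning
labelsF-↭ (Perm.trans p q) = ↭-trans (labelsF-↭ p) (labelsF-↭ q)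

∈-labelsF⁺ : ∀ {T v} cs → T ∈ cs → v ∈ labels T → v ∈ labelsF cs
∈-labelsF⁺ (c ∷ cs) (here refl) v∈ = ∈-++⁺ˡ v∈
∈-labelsF⁺ (c ∷ cs) (there T∈)  v∈ = ∈-++⁺ʳ (labels c) (∈-labelsF⁺ cs T∈ v∈)

-- A zipper: each frame (v , ls , rs) is a vertex v whose children are ls, the hole, then rs.
Frame : Set
Frame = ℕ × List Tree × List Tree

Ctx : Set
Ctx = List Frame

plug : Ctx → Tree → Tree
plug []                  s = s
plug ((v , ls , rs) ∷ C) s = plug C (node v (ls ++ s ∷ rs))

plug-++ : ∀ C C′ s → plug (C ++ C′) s ≡ plug C′ (plug C s)
plug-++ []                  C′ s = refl
plug-++ ((v , ls , rs) ∷ C) C′ s = plug-++ C C′ (node v (ls ++ s ∷ rs))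

ctxLabels : Ctx → List ℕ
ctxLabels []                  = []
ctxLabels ((v , ls , rs) ∷ C) = ctxLabels C ++ v ∷ labelsF ls ++ labelsF rs

labels-replace : ∀ v ls s rs → labels (node v (ls ++ s ∷ rs)) ↭ (v ∷ labelsF ls ++ labelsF rs) ++ labels s
labels-replace v ls s rs rewrite labelsF-++ ls (s ∷ rs) = prep v (begin
  labelsF ls ++ labels s ++ labelsF rs   ↭⟨ ++⁺ˡ (labelsF ls) (++-comm-↭ (labels s) (labelsF rs)) ⟩
  labelsF ls ++ labelsF rs ++ labels s   ≡⟨ sym (++-assoc (labelsF ls) (labelsF rs) (labels s)) ⟩
  (labelsF ls ++ labelsF rs) ++ labels s ∎)
  where open PermutationReasoning

labels-plug : ∀ C s → labels (plug C s) ↭ ctxLabels C ++ labels s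
labels-plug []                  s = ↭-refl
labels-plug ((v , ls , rs) ∷ C) s = begin
  labels (plug C (node v (ls ++ s ∷ rs)))           ↭⟨ labels-plug C _ ⟩
  ctxLabels C ++ labels (node v (ls ++ s ∷ rs))     ↭⟨ ++⁺ˡ (ctxLabels C) (labels-replace v ls s rs) ⟩
  ctxLabels C ++ (v ∷ labelsF ls ++ labelsF rs) ++ labels s ≡⟨ sym (++-assoc (ctxLabels C) _ (labels s)) ⟩
  (ctxLabels C ++ v ∷ labelsF ls ++ labelsF rs) ++ labels s ∎
  where open PermutationReasoning

root-plug-∷ : ∀ f C s s′ → root (plug (f ∷ C) s) ≡ root (plug (f ∷ C) s′)
root-plug-∷ (v , ls , rs) []      s s′ = refl
root-plug-∷ (v , ls , rs) (g ∷ C) s s′ = root-plug-∷ g C _ _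

root-plug-∷-∈ : ∀ f C s → root (plug (f ∷ C) s) ∈ ctxLabels (f ∷ C)
root-plug-∷-∈ (v , ls , rs) []      s = here refl
root-plug-∷-∈ (v , ls , rs) (g ∷ C) s = ∈-++⁺ˡ (root-plug-∷-∈ g C _)

mutual
  locate : ℕ → Tree → Maybe (Ctx × List Tree)
  locate μ (node v cs) = if does (v ≟ μ) then just ([] , cs) else locateF μ v [] cs

  locateF : ℕ → ℕ → List Tree → List Tree → Maybe (Ctx × List Tree)
  locateF μ v done []       = nothing
  locateF μ v done (c ∷ rs) with locate μ c
  ... | just (C , d) = just (C ++ [ (v , done , rs) ] , d)
  ... | nothing      = locateF μ v (done ++ [ c ]) rs

mutual
  locate-∉ : ∀ μ T → μ ∉ labels T → locate μ T ≡ nothing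
  locate-∉ μ (node v cs) μ∉ with does (v ≟ μ) | proof (v ≟ μ)
  ... | true  | ofʸ refl = ⊥-elim (μ∉ (here refl))
  ... | false | ofⁿ _    = locateF-∉ μ v [] cs (λ μ∈ → μ∉ (there μ∈))

  locateF-∉ : ∀ μ v done cs → μ ∉ labelsF cs → locateF μ v done cs ≡ nothing
  locateF-∉ μ v done []       μ∉ = refl
  locateF-∉ μ v done (c ∷ rs) μ∉ with locate μ c | locate-∉ μ c (λ μ∈ → μ∉ (∈-++⁺ˡ μ∈))
  ... | nothing | _ = locateF-∉ μ v (done ++ [ c ]) rs (λ μ∈ → μ∉ (∈-++⁺ʳ (labels c) μ∈))

locateF-skip : ∀ μ v done ls rest → μ ∉ labelsF ls →
  locateF μ v done (ls ++ rest) ≡ locateF μ v (done ++ ls) rest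
locateF-skip μ v done []       rest μ∉ rewrite ++-identityʳ done = refl
locateF-skip μ v done (l ∷ ls) rest μ∉ with locate μ l | locate-∉ μ l (λ μ∈ → μ∉ (∈-++⁺ˡ μ∈))
... | nothing | _
  rewrite locateF-skip μ v (done ++ [ l ]) ls rest (λ μ∈ → μ∉ (∈-++⁺ʳ (labels l) μ∈))
        | ++-assoc done [ l ] ls = refl

locateF-hit : ∀ μ v done s rs C d → locate μ s ≡ just (C , d) →
  locateF μ v done (s ∷ rs) ≡ just (C ++ [ (v , done , rs) ] , d)
locateF-hit μ v done s rs C d found with locate μ s
locateF-hit μ v done s rs C d refl | just _ = refl

locate-plug : ∀ μ C s C₀ d → μ ∉ ctxLabels C → locate μ s ≡ just (C₀ , d) →
  locate μ (plug C s) ≡ just (C₀ ++ C , d)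
locate-plug μ []                  s C₀ d μ∉ found rewrite ++-identityʳ C₀ = found
locate-plug μ ((v , ls , rs) ∷ C) s C₀ d μ∉ found =
  trans (locate-plug μ C (node v (ls ++ s ∷ rs)) (C₀ ++ [ (v , ls , rs) ]) d (λ μ∈ → μ∉ (∈-++⁺ˡ μ∈))
                     in-frame)
        (cong (λ C′ → just (C′ , d)) (++-assoc C₀ [ (v , ls , rs) ] C))
  where
  in-frame : locate μ (node v (ls ++ s ∷ rs)) ≡ just (C₀ ++ [ (v , ls , rs) ] , d)
  in-frame with does (v ≟ μ) | proof (v ≟ μ)
  ... | true  | ofʸ refl = ⊥-elim (μ∉ (∈-++⁺ʳ (ctxLabels C) (here refl)))
  ... | false | ofⁿ _    =
    trans (locateF-skip μ v [] ls (s ∷ rs) (λ μ∈ → μ∉ (∈-++⁺ʳ (ctxLabels C) (there (∈-++⁺ˡ μ∈)))))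
          (locateF-hit μ v ls s rs C₀ d found)

locate-plug-node : ∀ μ C d → μ ∉ ctxLabels C → locate μ (plug C (node μ d)) ≡ just (C , d)
locate-plug-node μ C d μ∉ = locate-plug μ C (node μ d) [] d μ∉ at-root
  where
  at-root : locate μ (node μ d) ≡ just ([] , d)
  at-root with does (μ ≟ μ) | proof (μ ≟ μ)
  ... | true  | _        = refl
  ... | false | ofⁿ μ≢μ = ⊥-elim (μ≢μ refl)

mutual
  plug-decompose : ∀ μ T → μ ∈ labels T → ∃₂ λ C d → T ≡ plug C (node μ d)
  plug-decompose μ (node v cs) (here refl) = [] , cs , refl
  plug-decompose μ (node v cs) (there μ∈)  = plug-decomposeF μ v [] cs μ∈

  plug-decomposeF : ∀ μ v done cs → μ ∈ labelsF cs → ∃₂ λ C d → node v (done ++ cs) ≡ plug C (node μ d)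
  plug-decomposeF μ v done (c ∷ rs) μ∈ with ∈-++⁻ (labels c) μ∈
  ... | inj₁ μ∈c with plug-decompose μ c μ∈c
  ...   | C , d , refl = C ++ [ (v , done , rs) ] , d , sym (plug-++ C [ (v , done , rs) ] (node μ d))
  plug-decomposeF μ v done (c ∷ rs) μ∈ | inj₂ μ∈rs with plug-decomposeF μ v (done ++ [ c ]) rs μ∈rs
  ... | C , d , eq = C , d , trans (cong (node v) (sym (++-assoc done [ c ] rs))) eq

youngF-++ : ∀ xs ys i → youngF (xs ++ ys) i ≡ youngF xs i + youngF ys i
youngF-++ []       ys i = refl
youngF-++ (x ∷ xs) ys i rewrite youngF-++ xs ys i = sym (ℕ.+-assoc (young x i) _ _)

mutual
  young-∉ : ∀ T i → i ∉ labels T → young T i ≡ 0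
  young-∉ (node v cs) i i∉ with does (v ≟ i) | proof (v ≟ i)
  ... | true  | ofʸ refl = ⊥-elim (i∉ (here refl))
  ... | false | ofⁿ _    = youngF-∉ cs i (λ i∈ → i∉ (there i∈))

  youngF-∉ : ∀ cs i → i ∉ labelsF cs → youngF cs i ≡ 0
  youngF-∉ []       i i∉ = refl
  youngF-∉ (c ∷ cs) i i∉ rewrite young-∉ c i (λ i∈ → i∉ (∈-++⁺ˡ i∈)) =
    youngF-∉ cs i (λ i∈ → i∉ (∈-++⁺ʳ (labels c) i∈))

young-plug : ∀ C s i → i ∉ ctxLabels C → young (plug C s) i ≡ young s i
young-plug []                  s i i∉ = refl
young-plug ((v , ls , rs) ∷ C) s i i∉
  rewrite young-plug C (node v (ls ++ s ∷ rs)) i (λ i∈ → i∉ (∈-++⁺ˡ i∈))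
  with does (v ≟ i) | proof (v ≟ i)
... | true  | ofʸ refl = ⊥-elim (i∉ (∈-++⁺ʳ (ctxLabels C) (here refl)))
... | false | ofⁿ _
  rewrite youngF-++ ls (s ∷ rs) i
        | youngF-∉ ls i (λ i∈ → i∉ (∈-++⁺ʳ (ctxLabels C) (there (∈-++⁺ˡ i∈))))
        | youngF-∉ rs i (λ i∈ → i∉ (∈-++⁺ʳ (ctxLabels C) (there (∈-++⁺ʳ (labelsF ls) i∈)))) =
  ℕ.+-identityʳ (young s i)

young-root : ∀ μ d → μ ∉ labelsF d → young (node μ d) μ ≡ youngCh d
young-root μ d μ∉ with does (μ ≟ μ) | proof (μ ≟ μ)
... | true  | _        rewrite youngF-∉ d μ μ∉ = ℕ.+-identityʳ (youngCh d)
... | false | ofⁿ μ≢μ = ⊥-elim (μ≢μ refl)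

-- Contraction at the smallest non-root vertex

Unique-labelsF⇒DistinctMinima : ∀ cs → Unique (labelsF cs) → DistinctMinima cs
Unique-labelsF⇒DistinctMinima []       _ = []
Unique-labelsF⇒DistinctMinima (c ∷ cs) u =
  β∉ cs (λ v∈ → Unique-++⇒disjoint (labels c) u (β-∈ c) v∈)
  ∷ Unique-labelsF⇒DistinctMinima cs (Unique-++⁻ʳ (labels c) u)
  where
  β∉ : ∀ ds → (∀ {v} → v ∈ labelsF ds → β c ≢ v) → All (β c ≢_) (map β ds)
  β∉ []       _   = []
  β∉ (d ∷ ds) β≢ = β≢ (∈-++⁺ˡ (β-∈ d)) ∷ β∉ ds (λ v∈ → β≢ (∈-++⁺ʳ (labels d) v∈))

partsLabels : List Tree → List Tree → List Tree → List ℕ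
partsLabels L R D = labelsF L ++ labelsF R ++ labelsF D

labelsF-joined : ∀ L R D → labelsF (L ++ R ++ D) ≡ partsLabels L R D
labelsF-joined L R D rewrite labelsF-++ L (R ++ D) | labelsF-++ R D = refl

∈-partsLabels-L : ∀ L R D {v} → v ∈ labelsF L → v ∈ partsLabels L R D
∈-partsLabels-L L R D = ∈-++⁺ˡ

∈-partsLabels-R : ∀ L R D {v} → v ∈ labelsF R → v ∈ partsLabels L R D
∈-partsLabels-R L R D v∈ = ∈-++⁺ʳ (labelsF L) (∈-++⁺ˡ v∈)

∈-partsLabels-D : ∀ L R D {v} → v ∈ labelsF D → v ∈ partsLabels L R D
∈-partsLabels-D L R D v∈ = ∈-++⁺ʳ (labelsF L) (∈-++⁺ʳ (labelsF R) v∈)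

∈-partsLabels-LR : ∀ L R D {v} → v ∈ labelsF L ++ labelsF R → v ∈ partsLabels L R D
∈-partsLabels-LR L R D v∈ with ∈-++⁻ (labelsF L) v∈
... | inj₁ v∈L = ∈-partsLabels-L L R D v∈L
... | inj₂ v∈R = ∈-partsLabels-R L R D v∈R

labels-around : ∀ C p L R μ D →
  labels (plug C (node p (L ++ node μ D ∷ R))) ↭ ctxLabels C ++ p ∷ μ ∷ partsLabels L R D
labels-around C p L R μ D = begin
  labels (plug C (node p (L ++ node μ D ∷ R)))                     ↭⟨ labels-plug C _ ⟩
  ctxLabels C ++ labels (node p (L ++ node μ D ∷ R))
    ↭⟨ ++⁺ˡ (ctxLabels C) (labels-replace p L (node μ D) R) ⟩
  ctxLabels C ++ (p ∷ labelsF L ++ labelsF R) ++ μ ∷ labelsF D    ↭⟨ ++⁺ˡ (ctxLabels C) (prep p μ-first) ⟩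
  ctxLabels C ++ p ∷ μ ∷ partsLabels L R D                         ∎
  where
  open PermutationReasoning
  μ-first : (labelsF L ++ labelsF R) ++ μ ∷ labelsF D ↭ μ ∷ partsLabels L R D
  μ-first = begin
    (labelsF L ++ labelsF R) ++ μ ∷ labelsF D ↭⟨ shift μ (labelsF L ++ labelsF R) (labelsF D) ⟩
    μ ∷ (labelsF L ++ labelsF R) ++ labelsF D ≡⟨ cong (μ ∷_) (++-assoc (labelsF L) _ _) ⟩
    μ ∷ partsLabels L R D                     ∎

IsTreeOn : List ℕ → ℕ → Tree → Set
IsTreeOn S r T = (root T ≡ r) × (labels T ↭ S)

newRoot : ℕ → ℕ → ℕ → ℕ
newRoot r μ p = if does (p ≟ r) then μ else r

newRoot-root : ∀ r μ → newRoot r μ r ≡ μ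
newRoot-root r μ with does (r ≟ r) | proof (r ≟ r)
... | true  | _        = refl
... | false | ofⁿ r≢r = ⊥-elim (r≢r refl)

newRoot-other : ∀ r μ p → p ≢ r → newRoot r μ p ≡ r
newRoot-other r μ p p≢r with does (p ≟ r) | proof (p ≟ r)
... | true  | ofʸ p≡r = ⊥-elim (p≢r p≡r)
... | false | _        = refl

Contracted : Set
Contracted = ℕ × Tree × List Origin

-- The last clause is junk: it only applies when μ is absent or is the root.
contractAt : ℕ → Tree → Maybe (Ctx × List Tree) → Contracted
contractAt μ T (just ((p , L , R) ∷ C , D)) = p , plug C (node μ (proj₁ (merge L R D))) , proj₂ (merge L R D)
contractAt μ T _                            = 0 , T , []

contract : ℕ → Tree → Contracted
contract μ T = contractAt μ T (locate μ T)

expandAt : ℕ → ℕ → List Origin → Tree → Maybe (Ctx × List Tree) → Tree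
expandAt μ p gs T′ (just (C , E)) =
  plug ((p , part left (unmerge E gs) , part right (unmerge E gs)) ∷ C) (node μ (part below (unmerge E gs)))
expandAt μ p gs T′ nothing        = T′

expand : ℕ → Contracted → Tree
expand μ (p , T′ , gs) = expandAt μ p gs T′ (locate μ T′)

module _ {c : Tree} where

  youngCh-smallest-middle : ∀ L R → (∀ {z} → z ∈ L → β c < β z) → (∀ {z} → z ∈ R → β c < β z) →
    youngCh (L ++ c ∷ R) ≡ suc (youngCh R)
  youngCh-smallest-middle [] R _ c<R rewrite anySmaller-false⁺ (β c) R (λ z∈ → <⇒≤ (c<R z∈)) = refl
  youngCh-smallest-middle (l ∷ L) R c<L c<R
    rewrite anySmaller-true⁺ {β l} (L ++ c ∷ R) (∈-++⁺ʳ L (here refl)) (c<L (here refl)) =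
    youngCh-smallest-middle L R (λ z∈ → c<L (there z∈)) c<R

  elderCh-smallest-middle : ∀ L R → (∀ {z} → z ∈ L → β c < β z) → (∀ {z} → z ∈ R → β c < β z) →
    elderCh (L ++ c ∷ R) ≡ length L + elderCh R
  elderCh-smallest-middle [] R _ c<R rewrite anySmaller-false⁺ (β c) R (λ z∈ → <⇒≤ (c<R z∈)) = refl
  elderCh-smallest-middle (l ∷ L) R c<L c<R
    rewrite anySmaller-true⁺ {β l} (L ++ c ∷ R) (∈-++⁺ʳ L (here refl)) (c<L (here refl)) =
    cong suc (elderCh-smallest-middle L R (λ z∈ → c<L (there z∈)) c<R)

root-plug-cases : ∀ r C s → root (plug C s) ≡ r → (C ≡ [] × r ≡ root s) ⊎ (C ≢ [] × r ∈ ctxLabels C)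
root-plug-cases r []      s root≡ = inj₁ (refl , sym root≡)
root-plug-cases r (f ∷ C) s root≡ = inj₂ ((λ ()) , subst (_∈ ctxLabels (f ∷ C)) root≡ (root-plug-∷-∈ f C s))

root-contracted : ∀ r μ C p s s′ → root (plug C s) ≡ r → root s′ ≡ μ → p ∉ ctxLabels C → root s ≡ p →
  root (plug C s′) ≡ newRoot r μ p
root-contracted r μ []      p s s′ refl root′ p∉ refl = trans root′ (sym (newRoot-root (root s) μ))
root-contracted r μ (f ∷ C) p s s′ root≡ _ p∉ refl =
  trans (trans (root-plug-∷ f C s′ s) root≡)
        (sym (newRoot-other r μ (root s)
          λ p≡r → p∉ (subst (_∈ ctxLabels (f ∷ C)) (trans root≡ (sym p≡r)) (root-plug-∷-∈ f C s))))

root-expanded : ∀ r μ C p s s′ → root (plug C s′) ≡ newRoot r μ p → root s′ ≡ μ →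
  μ ∉ ctxLabels C → μ ≢ r →
  root s ≡ p → root (plug C s) ≡ r
root-expanded r μ C p s s′ root′≡ root′ μ∉ μ≢r refl with does (root s ≟ r) | proof (root s ≟ r) | C
... | true  | ofʸ p≡r | []    = p≡r
... | true  | _       | f ∷ C′ =
  ⊥-elim (μ∉ (subst (_∈ ctxLabels (f ∷ C′)) root′≡ (root-plug-∷-∈ f C′ s′)))
... | false | _       | []    = ⊥-elim (μ≢r (trans (sym root′) root′≡))
... | false | _       | f ∷ C′ = trans (root-plug-∷ f C′ s s′) root′≡

record LocalShape (C : Ctx) (p μ : ℕ) (L R D : List Tree) : Set where
  field
    μ∉C          : μ ∉ ctxLabels C
    μ∉parts      : μ ∉ partsLabels L R D
    unique-parts : Unique (partsLabels L R D)
    μ<parts      : ∀ {v} → v ∈ partsLabels L R D → μ < v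
    μ<p          : C ≢ [] → μ < p
    μ≢p          : μ ≢ p
    p∉C          : p ∉ ctxLabels C

module SmallestNonRoot {S : List ℕ} {r μ : ℕ} (S-unique : Unique S) (μ∈S : μ ∈ S) (μ≢r : μ ≢ r)
                       (μ-min : ∀ {v} → v ∈ S → v ≢ r → μ ≤ v) where

  localShape : ∀ C p L R D → IsTreeOn S r (plug C (node p (L ++ node μ D ∷ R))) → LocalShape C p μ L R D
  localShape C p L R D (root≡ , labels↭) = record
    { μ∉C          = λ μ∈ → Unique-++⇒disjoint (ctxLabels C) uX μ∈ (there (here refl)) refl
    ; μ∉parts      = μ∉parts
    ; unique-parts = unique-parts
    ; μ<parts      = λ v∈ → ≤∧≢⇒< (μ-min (∈S (∈-++⁺ʳ (ctxLabels C) (there (there v∈)))) (v≢r v∈))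
                                  (λ μ≡v → μ∉parts (subst (_∈ partsLabels L R D) (sym μ≡v) v∈))
    ; μ<p          = λ C≢[] →
                       ≤∧≢⇒< (μ-min (∈S (∈-++⁺ʳ (ctxLabels C) (here refl))) (p≢r C≢[])) (≢-sym p≢μ)
    ; μ≢p          = ≢-sym p≢μ
    ; p∉C          = λ p∈ → Unique-++⇒disjoint (ctxLabels C) uX p∈ (here refl) refl
    }
    where
    X : List ℕ
    X = ctxLabels C ++ p ∷ μ ∷ partsLabels L R D
    X↭S : X ↭ S
    X↭S = ↭-trans (↭-sym (labels-around C p L R μ D)) labels↭
    uX : Unique X
    uX = Unique-resp-↭ (↭-sym X↭S) S-unique
    ∈S : ∀ {v} → v ∈ X → v ∈ S
    ∈S = ∈-resp-↭ X↭S
    p∷μ∷parts : Unique (p ∷ μ ∷ partsLabels L R D)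
    p∷μ∷parts = Unique-++⁻ʳ (ctxLabels C) uX
    p≢μ : p ≢ μ
    p≢μ p≡μ = Unique[x∷xs]⇒x∉xs p∷μ∷parts (here p≡μ)
    μ∉parts : μ ∉ partsLabels L R D
    μ∉parts with p∷μ∷parts
    ... | _ ∷ μ∷parts = Unique[x∷xs]⇒x∉xs μ∷parts
    unique-parts : Unique (partsLabels L R D)
    unique-parts with p∷μ∷parts
    ... | _ ∷ _ ∷ u = u
    root-location : (C ≡ [] × r ≡ p) ⊎ (C ≢ [] × r ∈ ctxLabels C)
    root-location = root-plug-cases r C _ root≡
    v≢r : ∀ {v} → v ∈ partsLabels L R D → v ≢ r
    v≢r v∈ refl with root-location
    ... | inj₁ (refl , refl) = Unique[x∷xs]⇒x∉xs p∷μ∷parts (there v∈)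
    ... | inj₂ (_ , r∈C)     = Unique-++⇒disjoint (ctxLabels C) uX r∈C (there (there v∈)) refl
    p≢r : C ≢ [] → p ≢ r
    p≢r C≢[] refl with root-location
    ... | inj₁ (C≡[] , _) = C≢[] C≡[]
    ... | inj₂ (_ , r∈C)  = Unique-++⇒disjoint (ctxLabels C) uX r∈C (here refl) refl

  module Contraction (C : Ctx) (p : ℕ) (L R D : List Tree)
                     (valid : IsTreeOn S r (plug C (node p (L ++ node μ D ∷ R)))) where
    open LocalShape (localShape C p L R D valid) public

    T : Tree
    T = plug C (node p (L ++ node μ D ∷ R))

    E : List Tree
    E = proj₁ (merge L R D)

    gs : List Origin
    gs = proj₂ (merge L R D)

    T′ : Tree
    T′ = plug C (node μ E)

    μ∉frame : μ ∉ ctxLabels ((p , L , R) ∷ C)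
    μ∉frame μ∈ with ∈-++⁻ (ctxLabels C) μ∈
    ... | inj₁ μ∈C          = μ∉C μ∈C
    ... | inj₂ (here μ≡p)   = μ≢p μ≡p
    ... | inj₂ (there μ∈LR) = μ∉parts (∈-partsLabels-LR L R D μ∈LR)

    contract≡ : contract μ T ≡ (p , T′ , gs)
    contract≡ = cong (contractAt μ T) (locate-plug-node μ ((p , L , R) ∷ C) D μ∉frame)

    parts-distinct : DistinctMinima (L ++ R ++ D)
    parts-distinct =
      Unique-labelsF⇒DistinctMinima (L ++ R ++ D) (subst Unique (sym (labelsF-joined L R D)) unique-parts)

    merge-correct : MergeOf (L , R , D) E gs
    merge-correct = mergeParts-MergeOf _ (L , R , D) refl parts-distinct

    E↭parts : E ↭ L ++ R ++ D
    E↭parts = ↭-sym (subst (λ P → joined P ↭ E) (MergeOf.unmerge≡ merge-correct) (unmerge-↭ E gs))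

    labelsF-E : labelsF E ↭ partsLabels L R D
    labelsF-E = subst (labelsF E ↭_) (labelsF-joined L R D) (labelsF-↭ E↭parts)

    μ∉E : μ ∉ labelsF E
    μ∉E μ∈ = μ∉parts (∈-resp-↭ labelsF-E μ∈)

    E-distinct : DistinctMinima E
    E-distinct = DistinctMinima-↭ (↭-sym E↭parts) parts-distinct

    p∈S : p ∈ S
    p∈S = ∈-resp-↭ (proj₂ valid)
            (∈-resp-↭ (↭-sym (labels-around C p L R μ D)) (∈-++⁺ʳ (ctxLabels C) (here refl)))

    contracted-valid : IsTreeOn (delete p S) (newRoot r μ p) T′
    contracted-valid =
      root-contracted r μ C p (node p (L ++ node μ D ∷ R)) (node μ E) (proj₁ valid) refl p∉C refl ,
      drop-∷ (begin
        p ∷ labels T′                                   ↭⟨ prep p (labels-plug C (node μ E)) ⟩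
        p ∷ ctxLabels C ++ μ ∷ labelsF E                ↭⟨ prep p (++⁺ˡ (ctxLabels C) (prep μ labelsF-E)) ⟩
        p ∷ ctxLabels C ++ μ ∷ partsLabels L R D        ↭⟨ ↭-sym (shift p (ctxLabels C) _) ⟩
        ctxLabels C ++ p ∷ μ ∷ partsLabels L R D        ↭⟨ ↭-sym (labels-around C p L R μ D) ⟩
        labels T                                        ↭⟨ proj₂ valid ⟩
        S                                               ↭⟨ delete-↭ S p∈S ⟩
        p ∷ delete p S                                  ∎)
      where open PermutationReasoning

    contracted-length : length gs ≡ young T′ μ
    contracted-length =
      trans (MergeOf.length≡ merge-correct) (sym (trans (young-plug C (node μ E) μ μ∉C) (young-root μ E μ∉E)))

    expand-contracted : expand μ (p , T′ , gs) ≡ T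
    expand-contracted =
      trans (cong (expandAt μ p gs T′) (locate-plug-node μ C E μ∉C))
            (cong (λ P → plug ((p , part left P , part right P) ∷ C) (node μ (part below P)))
                  (MergeOf.unmerge≡ merge-correct))

    μ≤subtree : ∀ ds → (∀ {v} → v ∈ labelsF ds → v ∈ partsLabels L R D) →
      ∀ {v} → v ∈ labels (node μ ds) → μ ≤ v
    μ≤subtree ds ⊆parts (here refl) = ≤-refl
    μ≤subtree ds ⊆parts (there v∈)  = <⇒≤ (μ<parts (⊆parts v∈))

    β-below : β (node μ D) ≡ μ
    β-below = β-≡ (node μ D) (here refl) (μ≤subtree D (∈-partsLabels-D L R D))

    β-contracted : β (node μ E) ≡ μ
    β-contracted = β-≡ (node μ E) (here refl) (μ≤subtree E (∈-resp-↭ labelsF-E))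

    β-parent : C ≢ [] → β (node p (L ++ node μ D ∷ R)) ≡ μ
    β-parent C≢[] = β-≡ s (∈-resp-↭ (↭-sym (labels-around [] p L R μ D)) (there (here refl))) μ≤
      where
      s : Tree
      s = node p (L ++ node μ D ∷ R)
      μ≤ : ∀ {v} → v ∈ labels s → μ ≤ v
      μ≤ v∈ with ∈-resp-↭ (labels-around [] p L R μ D) v∈
      ... | here refl          = <⇒≤ (μ<p C≢[])
      ... | there (here refl)  = ≤-refl
      ... | there (there v∈′)  = <⇒≤ (μ<parts v∈′)

    β-below<siblings : ∀ {X} → (∀ {v} → v ∈ labelsF X → v ∈ partsLabels L R D) →
      ∀ {z} → z ∈ X → β (node μ D) < β z
    β-below<siblings ⊆parts z∈ = subst (_< _) (sym β-below) (μ<parts (⊆parts (∈-labelsF⁺ _ z∈ (β-∈ _))))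

    youngCh-parent : youngCh (L ++ node μ D ∷ R) ≡ suc (youngCh R)
    youngCh-parent =
      youngCh-smallest-middle L R (β-below<siblings (∈-partsLabels-L L R D)) (β-below<siblings (∈-partsLabels-R L R D))

    elderCh-parent : elderCh (L ++ node μ D ∷ R) ≡ length L + elderCh R
    elderCh-parent =
      elderCh-smallest-middle L R (β-below<siblings (∈-partsLabels-L L R D)) (β-below<siblings (∈-partsLabels-R L R D))

  record IsContraction (p : ℕ) (T′ : Tree) (gs : List Origin) : Set where
    field
      p∈S     : p ∈ S
      p≢μ     : p ≢ μ
      valid   : IsTreeOn (delete p S) (newRoot r μ p) T′
      length≡ : length gs ≡ young T′ μ

  ValidContracted : Contracted → Set
  ValidContracted (p , T′ , gs) = IsContraction p T′ gs

  module Expansion (p : ℕ) (C : Ctx) (E : List Tree) (gs : List Origin)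
                   (V : IsContraction p (plug C (node μ E)) gs) where
    open IsContraction V

    T′ : Tree
    T′ = plug C (node μ E)

    P : Parts
    P = unmerge E gs

    L R D : List Tree
    L = part left P
    R = part right P
    D = part below P

    T : Tree
    T = plug C (node p (L ++ node μ D ∷ R))

    delete-unique : Unique (delete p S)
    delete-unique = Unique-delete⁺ p∈S S-unique

    around-μ : Unique (ctxLabels C ++ μ ∷ labelsF E)
    around-μ = Unique-resp-↭ (labels-plug C (node μ E)) (Unique-resp-↭ (↭-sym (proj₂ valid)) delete-unique)

    μ∉C : μ ∉ ctxLabels C
    μ∉C μ∈ = Unique-++⇒disjoint (ctxLabels C) around-μ μ∈ (here refl) refl

    μ∉E : μ ∉ labelsF E
    μ∉E = Unique[x∷xs]⇒x∉xs (Unique-++⁻ʳ (ctxLabels C) around-μ)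

    E-distinct : DistinctMinima E
    E-distinct with Unique-++⁻ʳ (ctxLabels C) around-μ
    ... | _ ∷ u = Unique-labelsF⇒DistinctMinima E u

    expand≡ : expand μ (p , T′ , gs) ≡ T
    expand≡ = cong (expandAt μ p gs T′) (locate-plug-node μ C E μ∉C)

    parts↭E : partsLabels L R D ↭ labelsF E
    parts↭E = subst (_↭ labelsF E) (labelsF-joined L R D) (labelsF-↭ (unmerge-↭ E gs))

    expanded-valid : IsTreeOn S r T
    expanded-valid =
      root-expanded r μ C p (node p (L ++ node μ D ∷ R)) (node μ E) (proj₁ valid) refl μ∉C μ≢r refl , (begin
      labels T                                 ↭⟨ labels-around C p L R μ D ⟩
      ctxLabels C ++ p ∷ μ ∷ partsLabels L R D ↭⟨ shift p (ctxLabels C) _ ⟩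
      p ∷ ctxLabels C ++ μ ∷ partsLabels L R D ↭⟨ prep p (++⁺ˡ (ctxLabels C) (prep μ parts↭E)) ⟩
      p ∷ ctxLabels C ++ μ ∷ labelsF E         ↭⟨ prep p (↭-sym (labels-plug C (node μ E))) ⟩
      p ∷ labels T′                            ↭⟨ prep p (proj₂ valid) ⟩
      p ∷ delete p S                           ↭⟨ ↭-sym (delete-↭ S p∈S) ⟩
      S                                        ∎)
      where open PermutationReasoning

    contract-expanded : contract μ T ≡ (p , T′ , gs)
    contract-expanded =
      trans (Contraction.contract≡ C p L R D expanded-valid)
            (cong (λ (E′ , gs′) → p , plug C (node μ E′) , gs′) (merge-unmerge E gs E-distinct length≡E))
      where
      length≡E : length gs ≡ youngCh E
      length≡E = trans length≡ (trans (young-plug C (node μ E) μ μ∉C) (young-root μ E μ∉E))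

  data AroundSmallest : Tree → Set where
    around : ∀ C p L R D → AroundSmallest (plug C (node p (L ++ node μ D ∷ R)))

  around-smallest : ∀ {T} → IsTreeOn S r T → AroundSmallest T
  around-smallest {T} (root≡ , labels↭) with plug-decompose μ T (∈-resp-↭ (↭-sym labels↭) μ∈S)
  ... | []                , D , refl = ⊥-elim (μ≢r root≡)
  ... | (p , L , R) ∷ C , D , refl = around C p L R D

  contract-valid : ∀ {T} → IsTreeOn S r T → ValidContracted (contract μ T)
  contract-valid valid with around-smallest valid
  ... | around C p L R D = subst ValidContracted (sym contract≡)
    record { p∈S = p∈S ; p≢μ = ≢-sym μ≢p ; valid = contracted-valid ; length≡ = contracted-length }
    where open Contraction C p L R D valid

  expand-contract : ∀ {T} → IsTreeOn S r T → expand μ (contract μ T) ≡ T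
  expand-contract valid with around-smallest valid
  ... | around C p L R D = trans (cong (expand μ) contract≡) expand-contracted
    where open Contraction C p L R D valid

  μ-in-contraction : ∀ p T′ gs → IsContraction p T′ gs → ∃₂ λ C E → T′ ≡ plug C (node μ E)
  μ-in-contraction p T′ gs V =
    plug-decompose μ T′ (∈-resp-↭ (↭-sym (proj₂ valid)) (∈-delete⁺ p∈S μ∈S (≢-sym p≢μ)))
    where open IsContraction V

  expand-valid : ∀ τ → ValidContracted τ → IsTreeOn S r (expand μ τ)
  expand-valid (p , T′ , gs) V with μ-in-contraction p T′ gs V
  ... | C , E , refl = subst (IsTreeOn S r) (sym expand≡) expanded-valid
    where open Expansion p C E gs V

  contract-expand : ∀ τ → ValidContracted τ → contract μ (expand μ τ) ≡ τ
  contract-expand (p , T′ , gs) V with μ-in-contraction p T′ gs V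
  ... | C , E , refl = trans (cong (contract μ) expand≡) contract-expanded
    where open Expansion p C E gs V

Enumerates : List Tree → List ℕ → ℕ → Set
Enumerates ts S r = ∀ T → (T ∈ ts) ⇔ IsTreeOn S r T

module ContractedTrees {S : List ℕ} {r μ : ℕ} (S-unique : Unique S) (μ∈S : μ ∈ S) (μ≢r : μ ≢ r)
                       (μ-min : ∀ {v} → v ∈ S → v ≢ r → μ ≤ v)
                       (ts : List Tree) (ts-enum : Enumerates ts S r) where
  open SmallestNonRoot S-unique μ∈S μ≢r μ-min

  contractedTree : Contracted → Tree
  contractedTree (_ , T′ , _) = T′

  contractionsAt : ℕ → List Tree
  contractionsAt p = map contractedTree (filter (λ τ → proj₁ τ ≟ p) (map (contract μ) ts))

  subtrees : ℕ → List Tree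
  subtrees p = deduplicate _≟ᵗ_ (contractionsAt p)

  subtrees-enumerates : ∀ {p} → p ∈ delete μ S → Enumerates (subtrees p) (delete p S) (newRoot r μ p)
  subtrees-enumerates {p} p∈ T′ = mk⇔ to from
    where
    to : T′ ∈ subtrees p → IsTreeOn (delete p S) (newRoot r μ p) T′
    to T′∈ with ∈-map∘filter⁻ contractedTree (λ τ → proj₁ τ ≟ p) (∈-deduplicate⁻ _≟ᵗ_ _ T′∈)
    ... | τ , τ∈ , refl , refl with ∈-map⁻ (contract μ) τ∈
    ...   | T , T∈ , refl = IsContraction.valid (contract-valid (Equivalence.to (ts-enum T) T∈))
    from : IsTreeOn (delete p S) (newRoot r μ p) T′ → T′ ∈ subtrees p
    from valid′ = Equivalence.to (deduplicate-∈⇔ _≟ᵗ_)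
      (∈-map∘filter⁺ contractedTree (λ τ → proj₁ τ ≟ p)
        (τ , subst (_∈ map (contract μ) ts) (contract-expand τ V) τ∈ , refl , refl))
      where
      -- Any word of origins of the right length is a witness.
      τ : Contracted
      τ = p , T′ , replicate (young T′ μ) left
      V : ValidContracted τ
      V = record { p∈S = ∈-delete⁻ μ∈S p∈ ; p≢μ = ∈-delete⇒≢ μ∈S S-unique p∈ ; valid = valid′
                 ; length≡ = length-replicate (young T′ μ) }
      τ∈ : contract μ (expand μ τ) ∈ map (contract μ) ts
      τ∈ = ∈-map⁺ (contract μ) (Equivalence.from (ts-enum (expand μ τ)) (expand-valid τ V))

  withOrigins : ℕ → Tree → List Contracted
  withOrigins p T′ = map (λ gs → p , T′ , gs) (words (young T′ μ))

  overParent : ℕ → List Contracted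
  overParent p = concatMap (withOrigins p) (subtrees p)

  candidates : List Contracted
  candidates = concatMap overParent (delete μ S)

  candidates-enumerate : ∀ τ → (τ ∈ candidates) ⇔ ValidContracted τ
  candidates-enumerate τ = mk⇔ to from
    where
    to : τ ∈ candidates → ValidContracted τ
    to τ∈ with find (∈-concatMap⁻ overParent {xs = delete μ S} τ∈)
    ... | p , p∈ , τ∈p with find (∈-concatMap⁻ (withOrigins p) {xs = subtrees p} τ∈p)
    ...   | T′ , T′∈ , τ∈T′ with ∈-map⁻ (λ gs → p , T′ , gs) τ∈T′
    ...     | gs , gs∈ , refl = record
      { p∈S = ∈-delete⁻ μ∈S p∈ ; p≢μ = ∈-delete⇒≢ μ∈S S-unique p∈
      ; valid = Equivalence.to (subtrees-enumerates p∈ T′) T′∈ ; length≡ = ∈-words⁻ _ gs∈ }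
    from : ValidContracted τ → τ ∈ candidates
    from V = ∈-concatMap⁺ overParent (lose p∈ (∈-concatMap⁺ (withOrigins p) (lose T′∈
               (∈-map⁺ (λ gs → p , T′ , gs) (subst (λ k → gs ∈ words k) length≡ (∈-words⁺ gs))))))
      where
      open IsContraction V
      p : ℕ
      p = proj₁ τ
      T′ : Tree
      T′ = proj₁ (proj₂ τ)
      gs : List Origin
      gs = proj₂ (proj₂ τ)
      p∈ : p ∈ delete μ S
      p∈ = ∈-delete⁺ μ∈S p∈S p≢μ
      T′∈ : T′ ∈ subtrees p
      T′∈ = Equivalence.from (subtrees-enumerates p∈ T′) valid

  candidates-unique : Unique candidates
  candidates-unique =
    Unique-concatMap⁺ overParent proj₁ (λ τ∈ → parent≡ (find (∈-concatMap⁻ _ τ∈)))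
      (Unique-delete⁺ μ∈S S-unique)
      (λ {p} _ → Unique-concatMap⁺ (withOrigins p) contractedTree tree≡ (deduplicate-! _≟ᵗ_ (contractionsAt p))
        (λ {T′} _ → Unique.map⁺ (cong (λ τ → proj₂ (proj₂ τ))) (words-unique (young T′ μ))))
    where
    tree≡ : ∀ {p T′ τ} → τ ∈ withOrigins p T′ → contractedTree τ ≡ T′
    tree≡ {p} {T′} τ∈ with ∈-map⁻ (λ gs → p , T′ , gs) τ∈
    ... | _ , _ , refl = refl
    parent≡ : ∀ {p τ} → (∃ λ T′ → T′ ∈ subtrees p × τ ∈ withOrigins p T′) → proj₁ τ ≡ p
    parent≡ {p} (T′ , _ , τ∈) with ∈-map⁻ (λ gs → p , T′ , gs) τ∈
    ... | _ , _ , refl = refl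

  contract-↭ : Unique ts → map (contract μ) ts ↭ candidates
  contract-↭ ts-unique =
    map-bijection-↭ (contract μ) (expand μ) ts-enum candidates-enumerate ts-unique candidates-unique
      contract-valid (λ {τ} → expand-valid τ) expand-contract (λ {τ} → contract-expand τ)

module _ {c ℓ} (𝓡 : CommutativeSemiring c ℓ) where

  open CommutativeSemiring 𝓡
    hiding (zero)
    renaming (_+_ to _⊕_; _*_ to _⊗_; refl to ≈-refl; sym to ≈-sym; trans to ≈-trans; setoid to ≈-setoid)
  open import Algebra.Definitions.RawSemiring rawSemiring using (_^_) renaming (_×_ to _·_)
  open import Algebra.Properties.Semiring.Exp semiring using (^-homo-*; ^-congˡ)
  open import Algebra.Properties.CommutativeSemigroup *-commutativeSemigroup
    using (interchange; x∙yz≈y∙xz; x∙yz≈xz∙y; xy∙z≈y∙xz; xy∙z≈xz∙y; xy∙z≈x∙zy)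
  open import Relation.Binary.Reasoning.Setoid ≈-setoid
  import Algebra.Solver.CommutativeMonoid *-commutativeMonoid as *-Solver

  -- Sums and weights in a commutative semiring

  Σ : List Carrier → Carrier
  Σ = sumL 𝓡

  Π : List Carrier → Carrier
  Π = prodL 𝓡

  Σ-++ : ∀ as bs → Σ (as ++ bs) ≈ Σ as ⊕ Σ bs
  Σ-++ []       bs = ≈-sym (+-identityˡ _)
  Σ-++ (a ∷ as) bs = ≈-trans (+-congˡ (Σ-++ as bs)) (≈-sym (+-assoc _ _ _))

  Σ-↭ : ∀ {as bs} → as ↭ bs → Σ as ≈ Σ bs
  Σ-↭ Perm.refl          = ≈-refl
  Σ-↭ (prep a p)         = +-congˡ (Σ-↭ p)
  Σ-↭ (swap a b p)       =
    ≈-trans (≈-sym (+-assoc a b _)) (≈-trans (+-cong (+-comm a b) (Σ-↭ p)) (+-assoc b a _))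
  Σ-↭ (Perm.trans p q)   = ≈-trans (Σ-↭ p) (Σ-↭ q)

  Π-↭ : ∀ {as bs} → as ↭ bs → Π as ≈ Π bs
  Π-↭ Perm.refl          = ≈-refl
  Π-↭ (prep a p)         = *-congˡ (Π-↭ p)
  Π-↭ (swap a b p)       =
    ≈-trans (≈-sym (*-assoc a b _)) (≈-trans (*-cong (*-comm a b) (Π-↭ p)) (*-assoc b a _))
  Π-↭ (Perm.trans p q)   = ≈-trans (Π-↭ p) (Π-↭ q)

  Σ-map-↭ : ∀ {A : Set} (f : A → Carrier) {xs ys} → xs ↭ ys → Σ (map f xs) ≈ Σ (map f ys)
  Σ-map-↭ f p = Σ-↭ (map⁺-↭ f p)

  Σ-cong : ∀ {A : Set} (xs : List A) {f g : A → Carrier} → (∀ {x} → x ∈ xs → f x ≈ g x) →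
    Σ (map f xs) ≈ Σ (map g xs)
  Σ-cong []       _   = ≈-refl
  Σ-cong (x ∷ xs) f≈g = +-cong (f≈g (here refl)) (Σ-cong xs (λ x∈ → f≈g (there x∈)))

  Π-cong : ∀ {A : Set} (xs : List A) {f g : A → Carrier} → (∀ {x} → x ∈ xs → f x ≈ g x) →
    Π (map f xs) ≈ Π (map g xs)
  Π-cong []       _   = ≈-refl
  Π-cong (x ∷ xs) f≈g = *-cong (f≈g (here refl)) (Π-cong xs (λ x∈ → f≈g (there x∈)))

  Σ-*ˡ : ∀ {A : Set} a (xs : List A) (f : A → Carrier) → Σ (map (λ x → a ⊗ f x) xs) ≈ a ⊗ Σ (map f xs)
  Σ-*ˡ a []       f = ≈-sym (zeroʳ a)
  Σ-*ˡ a (x ∷ xs) f = ≈-trans (+-congˡ (Σ-*ˡ a xs f)) (≈-sym (distribˡ a _ _))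

  Σ-concatMap : ∀ {A B : Set} (g : A → List B) (f : B → Carrier) xs →
    Σ (map f (concatMap g xs)) ≈ Σ (map (λ x → Σ (map f (g x))) xs)
  Σ-concatMap g f []       = ≈-refl
  Σ-concatMap g f (x ∷ xs) = begin
    Σ (map f (g x ++ concatMap g xs))                ≡⟨ cong Σ (map-++ f (g x) (concatMap g xs)) ⟩
    Σ (map f (g x) ++ map f (concatMap g xs))        ≈⟨ Σ-++ (map f (g x)) _ ⟩
    Σ (map f (g x)) ⊕ Σ (map f (concatMap g xs))     ≈⟨ +-congˡ (Σ-concatMap g f xs) ⟩
    Σ (map f (g x)) ⊕ Σ (map (λ y → Σ (map f (g y))) xs) ∎

  Σ-map-∘ : ∀ {A B : Set} (g : A → B) (f : B → Carrier) xs →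
    Σ (map f (map g xs)) ≡ Σ (map (λ x → f (g x)) xs)
  Σ-map-∘ g f xs = cong Σ (sym (map-∘ xs))

  Π-* : ∀ {A : Set} (xs : List A) (f g : A → Carrier) →
    Π (map (λ x → f x ⊗ g x) xs) ≈ Π (map f xs) ⊗ Π (map g xs)
  Π-* []       f g = ≈-sym (*-identityˡ 1#)
  Π-* (x ∷ xs) f g = ≈-trans (*-congˡ (Π-* xs f g)) (interchange (f x) (g x) _ _)

  Π-≈1 : ∀ {A : Set} (xs : List A) (f : A → Carrier) → (∀ {x} → x ∈ xs → f x ≈ 1#) → Π (map f xs) ≈ 1#
  Π-≈1 []       f _    = ≈-refl
  Π-≈1 (x ∷ xs) f f≈1 =
    ≈-trans (*-cong (f≈1 (here refl)) (Π-≈1 xs f (λ x∈ → f≈1 (there x∈)))) (*-identityˡ 1#)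

  1^ : ∀ n → 1# ^ n ≈ 1#
  1^ zero    = ≈-refl
  1^ (suc n) = ≈-trans (*-identityˡ _) (1^ n)

  update : (ℕ → Carrier) → ℕ → Carrier → ℕ → Carrier
  update x μ z v = if does (v ≟ μ) then z else x v

  update-same : ∀ x μ z → update x μ z μ ≡ z
  update-same x μ z with does (μ ≟ μ) | proof (μ ≟ μ)
  ... | true  | _        = refl
  ... | false | ofⁿ μ≢μ = ⊥-elim (μ≢μ refl)

  update-other : ∀ x μ z v → v ≢ μ → update x μ z v ≡ x v
  update-other x μ z v v≢μ with does (v ≟ μ) | proof (v ≟ μ)
  ... | true  | ofʸ v≡μ = ⊥-elim (v≢μ v≡μ)
  ... | false | _        = refl

  Π-single : ∀ (x : ℕ → Carrier) I v k → Unique I → v ∈ I →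
    Π (map (λ i → x i ^ (if does (v ≟ i) then k else 0)) I) ≈ x v ^ k
  Π-single x I v k I-unique v∈I = begin
    Π (map f I)                  ≈⟨ Π-↭ (map⁺-↭ f (delete-↭ I v∈I)) ⟩
    f v ⊗ Π (map f (delete v I)) ≈⟨ *-cong (reflexive at-v) (Π-≈1 (delete v I) f elsewhere) ⟩
    x v ^ k ⊗ 1#                 ≈⟨ *-identityʳ _ ⟩
    x v ^ k                      ∎
    where
    f : ℕ → Carrier
    f i = x i ^ (if does (v ≟ i) then k else 0)
    at-v : f v ≡ x v ^ k
    at-v with does (v ≟ v) | proof (v ≟ v)
    ... | true  | _        = refl
    ... | false | ofⁿ v≢v = ⊥-elim (v≢v refl)
    elsewhere : ∀ {i} → i ∈ delete v I → f i ≈ 1#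
    elsewhere {i} i∈ with does (v ≟ i) | proof (v ≟ i)
    ... | true  | ofʸ refl = ⊥-elim (∈-delete⇒≢ v∈I I-unique i∈ refl)
    ... | false | _        = ≈-refl

  module _ (t : Carrier) where

    mutual
      weight : (ℕ → Carrier) → Tree → Carrier
      weight x (node v cs) = x v ^ youngCh cs ⊗ (t ^ elderCh cs ⊗ weights x cs)

      weights : (ℕ → Carrier) → List Tree → Carrier
      weights x []       = 1#
      weights x (c ∷ cs) = weight x c ⊗ weights x cs

    weights≡Π : ∀ x cs → weights x cs ≡ Π (map (weight x) cs)
    weights≡Π x []       = refl
    weights≡Π x (c ∷ cs) = cong (weight x c ⊗_) (weights≡Π x cs)

    weights-++ : ∀ x cs ds → weights x (cs ++ ds) ≈ weights x cs ⊗ weights x ds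
    weights-++ x []       ds = ≈-sym (*-identityˡ _)
    weights-++ x (c ∷ cs) ds = ≈-trans (*-congˡ (weights-++ x cs ds)) (≈-sym (*-assoc _ _ _))

    weights-↭ : ∀ x {cs ds} → cs ↭ ds → weights x cs ≈ weights x ds
    weights-↭ x {cs} {ds} p = begin
      weights x cs           ≡⟨ weights≡Π x cs ⟩
      Π (map (weight x) cs)  ≈⟨ Π-↭ (map⁺-↭ (weight x) p) ⟩
      Π (map (weight x) ds)  ≡⟨ sym (weights≡Π x ds) ⟩
      weights x ds           ∎

    mutual
      weight-cong : ∀ x y T → (∀ {v} → v ∈ labels T → x v ≈ y v) → weight x T ≈ weight y T
      weight-cong x y (node v cs) x≈y =
        *-cong (^-congˡ (youngCh cs) (x≈y (here refl))) (*-congˡ (weights-cong x y cs (λ v∈ → x≈y (there v∈))))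

      weights-cong : ∀ x y cs → (∀ {v} → v ∈ labelsF cs → x v ≈ y v) → weights x cs ≈ weights y cs
      weights-cong x y []       _   = ≈-refl
      weights-cong x y (c ∷ cs) x≈y =
        *-cong (weight-cong x y c (λ v∈ → x≈y (∈-++⁺ˡ v∈)))
               (weights-cong x y cs (λ v∈ → x≈y (∈-++⁺ʳ (labels c) v∈)))

    weights-update-∉ : ∀ x μ z cs → μ ∉ labelsF cs → weights (update x μ z) cs ≈ weights x cs
    weights-update-∉ x μ z cs μ∉ =
      weights-cong (update x μ z) x cs
        (λ {v} v∈ → reflexive (update-other x μ z v (λ v≡μ → μ∉ (subst (_∈ labelsF cs) v≡μ v∈))))

    mutual
      weight-update : ∀ x μ z T → weight (update x μ z) T ≈ z ^ young T μ ⊗ weight (update x μ 1#) T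
      weight-update x μ z (node v cs) with does (v ≟ μ) | proof (v ≟ μ)
      ... | true | ofʸ refl = begin
        z ^ youngCh cs ⊗ (t ^ elderCh cs ⊗ weights (update x μ z) cs)
          ≈⟨ *-congˡ (*-congˡ (weights-update x μ z cs)) ⟩
        z ^ youngCh cs ⊗ (t ^ elderCh cs ⊗ (z ^ youngF cs μ ⊗ W₁))
          ≈⟨ *-congˡ (x∙yz≈y∙xz _ _ _) ⟩
        z ^ youngCh cs ⊗ (z ^ youngF cs μ ⊗ (t ^ elderCh cs ⊗ W₁))
          ≈⟨ ≈-sym (*-assoc _ _ _) ⟩
        (z ^ youngCh cs ⊗ z ^ youngF cs μ) ⊗ (t ^ elderCh cs ⊗ W₁)
          ≈⟨ *-cong (≈-sym (^-homo-* z (youngCh cs) (youngF cs μ))) (≈-sym (*-identityˡ _)) ⟩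
        z ^ (youngCh cs + youngF cs μ) ⊗ (1# ⊗ (t ^ elderCh cs ⊗ W₁))
          ≈⟨ *-congˡ (*-congʳ (≈-sym (1^ (youngCh cs)))) ⟩
        z ^ (youngCh cs + youngF cs μ) ⊗ (1# ^ youngCh cs ⊗ (t ^ elderCh cs ⊗ W₁)) ∎
        where
        W₁ : Carrier
        W₁ = weights (update x μ 1#) cs
      ... | false | _ = begin
        x v ^ youngCh cs ⊗ (t ^ elderCh cs ⊗ weights (update x μ z) cs)
          ≈⟨ *-congˡ (*-congˡ (weights-update x μ z cs)) ⟩
        x v ^ youngCh cs ⊗ (t ^ elderCh cs ⊗ (z ^ youngF cs μ ⊗ weights (update x μ 1#) cs))
          ≈⟨ *-congˡ (x∙yz≈y∙xz _ _ _) ⟩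
        x v ^ youngCh cs ⊗ (z ^ youngF cs μ ⊗ (t ^ elderCh cs ⊗ weights (update x μ 1#) cs))
          ≈⟨ x∙yz≈y∙xz _ _ _ ⟩
        z ^ youngF cs μ ⊗ (x v ^ youngCh cs ⊗ (t ^ elderCh cs ⊗ weights (update x μ 1#) cs)) ∎

      weights-update : ∀ x μ z cs → weights (update x μ z) cs ≈ z ^ youngF cs μ ⊗ weights (update x μ 1#) cs
      weights-update x μ z []       = ≈-sym (*-identityˡ _)
      weights-update x μ z (c ∷ cs) = begin
        weight (update x μ z) c ⊗ weights (update x μ z) cs
          ≈⟨ *-cong (weight-update x μ z c) (weights-update x μ z cs) ⟩
        (z ^ young c μ ⊗ weight (update x μ 1#) c) ⊗ (z ^ youngF cs μ ⊗ weights (update x μ 1#) cs)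
          ≈⟨ interchange _ _ _ _ ⟩
        (z ^ young c μ ⊗ z ^ youngF cs μ) ⊗ (weight (update x μ 1#) c ⊗ weights (update x μ 1#) cs)
          ≈⟨ *-congʳ (≈-sym (^-homo-* z (young c μ) (youngF cs μ))) ⟩
        z ^ (young c μ + youngF cs μ) ⊗ (weight (update x μ 1#) c ⊗ weights (update x μ 1#) cs) ∎

    Π-^-+ : ∀ (x : ℕ → Carrier) I (a b : ℕ → ℕ) →
      Π (map (λ i → x i ^ (a i + b i)) I) ≈ Π (map (λ i → x i ^ a i) I) ⊗ Π (map (λ i → x i ^ b i) I)
    Π-^-+ x I a b =
      ≈-trans (Π-cong I (λ {i} _ → ^-homo-* (x i) (a i) (b i))) (Π-* I (λ i → x i ^ a i) (λ i → x i ^ b i))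

    mutual
      monomial≈weight : ∀ x I → Unique I → ∀ T → (∀ {v} → v ∈ labels T → v ∈ I) →
        t ^ eld T ⊗ Π (map (λ i → x i ^ young T i) I) ≈ weight x T
      monomial≈weight x I I-unique (node v cs) ⊆I = begin
        t ^ (elderCh cs + eldF cs) ⊗ Π (map (λ i → x i ^ young (node v cs) i) I)
          ≈⟨ *-cong (^-homo-* t (elderCh cs) (eldF cs)) (Π-^-+ x I at-v (youngF cs)) ⟩
        (t ^ elderCh cs ⊗ t ^ eldF cs) ⊗ (Π (map (λ i → x i ^ at-v i) I) ⊗ Πcs)
          ≈⟨ *-congˡ (*-congʳ (Π-single x I v (youngCh cs) I-unique (⊆I (here refl)))) ⟩
        (t ^ elderCh cs ⊗ t ^ eldF cs) ⊗ (x v ^ youngCh cs ⊗ Πcs)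
          ≈⟨ ≈-trans (interchange _ _ _ _) (xy∙z≈y∙xz _ _ _) ⟩
        x v ^ youngCh cs ⊗ (t ^ elderCh cs ⊗ (t ^ eldF cs ⊗ Πcs))
          ≈⟨ *-congˡ (*-congˡ (monomials≈weights x I I-unique cs (λ v∈ → ⊆I (there v∈)))) ⟩
        weight x (node v cs) ∎
        where
        at-v : ℕ → ℕ
        at-v i = if does (v ≟ i) then youngCh cs else 0
        Πcs : Carrier
        Πcs = Π (map (λ i → x i ^ youngF cs i) I)

      monomials≈weights : ∀ x I → Unique I → ∀ cs → (∀ {v} → v ∈ labelsF cs → v ∈ I) →
        t ^ eldF cs ⊗ Π (map (λ i → x i ^ youngF cs i) I) ≈ weights x cs
      monomials≈weights x I I-unique [] _ = ≈-trans (*-identityˡ _) (Π-≈1 I (λ i → x i ^ 0) (λ _ → ≈-refl))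
      monomials≈weights x I I-unique (c ∷ cs) ⊆I = begin
        t ^ (eld c + eldF cs) ⊗ Π (map (λ i → x i ^ (young c i + youngF cs i)) I)
          ≈⟨ *-cong (^-homo-* t (eld c) (eldF cs)) (Π-^-+ x I (young c) (youngF cs)) ⟩
        (t ^ eld c ⊗ t ^ eldF cs) ⊗ (Πc ⊗ Πcs)
          ≈⟨ interchange _ _ _ _ ⟩
        (t ^ eld c ⊗ Πc) ⊗ (t ^ eldF cs ⊗ Πcs)
          ≈⟨ *-cong (monomial≈weight x I I-unique c (λ v∈ → ⊆I (∈-++⁺ˡ v∈)))
                    (monomials≈weights x I I-unique cs (λ v∈ → ⊆I (∈-++⁺ʳ (labels c) v∈))) ⟩
        weights x (c ∷ cs) ∎
        where
        Πc Πcs : Carrier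
        Πc  = Π (map (λ i → x i ^ young c i) I)
        Πcs = Π (map (λ i → x i ^ youngF cs i) I)

    weights-replace : ∀ x y ls rs s₁ s₂ a →
      (∀ {v} → v ∈ labelsF ls → x v ≈ y v) → (∀ {v} → v ∈ labelsF rs → x v ≈ y v) →
      weight x s₁ ≈ a ⊗ weight y s₂ → weights x (ls ++ s₁ ∷ rs) ≈ a ⊗ weights y (ls ++ s₂ ∷ rs)
    weights-replace x y ls rs s₁ s₂ a x≈y-ls x≈y-rs s₁≈ = begin
      weights x (ls ++ s₁ ∷ rs)                         ≈⟨ weights-++ x ls (s₁ ∷ rs) ⟩
      weights x ls ⊗ (weight x s₁ ⊗ weights x rs)
        ≈⟨ *-cong (weights-cong x y ls x≈y-ls) (*-cong s₁≈ (weights-cong x y rs x≈y-rs)) ⟩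
      weights y ls ⊗ ((a ⊗ weight y s₂) ⊗ weights y rs) ≈⟨ *-congˡ (*-assoc a _ _) ⟩
      weights y ls ⊗ (a ⊗ (weight y s₂ ⊗ weights y rs)) ≈⟨ x∙yz≈y∙xz _ a _ ⟩
      a ⊗ (weights y ls ⊗ (weight y s₂ ⊗ weights y rs)) ≈⟨ *-congˡ (≈-sym (weights-++ y ls (s₂ ∷ rs))) ⟩
      a ⊗ weights y (ls ++ s₂ ∷ rs)                     ∎

    -- A vertex sees its children only through their β, so a subtree may be replaced by one with the same β.
    weight-plug : ∀ C x y s₁ s₂ a → (∀ {v} → v ∈ ctxLabels C → x v ≈ y v) → C ≡ [] ⊎ β s₁ ≡ β s₂ →
      weight x s₁ ≈ a ⊗ weight y s₂ → weight x (plug C s₁) ≈ a ⊗ weight y (plug C s₂)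
    weight-plug []                  x y s₁ s₂ a _   _               s₁≈ = s₁≈
    weight-plug ((v , ls , rs) ∷ C) x y s₁ s₂ a x≈y (inj₂ βs₁≡βs₂) s₁≈ =
      weight-plug C x y (node v cs₁) (node v cs₂) a (λ v∈ → x≈y (∈-++⁺ˡ v∈))
        (inj₂ (minF-map-β v cs₁ cs₂ same-βs)) (begin
        x v ^ youngCh cs₁ ⊗ (t ^ elderCh cs₁ ⊗ weights x cs₁)
          ≡⟨ cong₂ (λ m n → x v ^ m ⊗ (t ^ n ⊗ weights x cs₁))
                   (youngCh-map-β cs₁ cs₂ same-βs) (elderCh-map-β cs₁ cs₂ same-βs) ⟩
        x v ^ youngCh cs₂ ⊗ (t ^ elderCh cs₂ ⊗ weights x cs₁)
          ≈⟨ *-cong (^-congˡ (youngCh cs₂) (x≈y (∈-++⁺ʳ (ctxLabels C) (here refl))))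
                    (*-congˡ (weights-replace x y ls rs s₁ s₂ a
                                (λ v∈ → x≈y (∈-++⁺ʳ (ctxLabels C) (there (∈-++⁺ˡ v∈))))
                                (λ v∈ → x≈y (∈-++⁺ʳ (ctxLabels C) (there (∈-++⁺ʳ (labelsF ls) v∈))))
                                s₁≈)) ⟩
        y v ^ youngCh cs₂ ⊗ (t ^ elderCh cs₂ ⊗ (a ⊗ weights y cs₂))
          ≈⟨ ≈-trans (*-congˡ (x∙yz≈y∙xz _ a _)) (x∙yz≈y∙xz _ a _) ⟩
        a ⊗ weight y (node v cs₂) ∎)
      where
      cs₁ cs₂ : List Tree
      cs₁ = ls ++ s₁ ∷ rs
      cs₂ = ls ++ s₂ ∷ rs
      same-βs : map β cs₁ ≡ map β cs₂
      same-βs = map-β-replace ls rs s₁ s₂ βs₁≡βs₂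

    originValue : Carrier → Carrier → Origin → Carrier
    originValue a b left  = t
    originValue a b right = a
    originValue a b below = b

    originsWeight : Carrier → Carrier → List Origin → Carrier
    originsWeight a b gs = Π (map (originValue a b) gs)

    originsWeight≈powers : ∀ a b gs →
      originsWeight a b gs ≈ t ^ count left gs ⊗ (a ^ count right gs ⊗ b ^ count below gs)
    originsWeight≈powers a b []           = ≈-sym (≈-trans (*-identityˡ _) (*-identityˡ _))
    originsWeight≈powers a b (left ∷ gs)  =
      ≈-trans (*-congˡ (originsWeight≈powers a b gs)) (≈-sym (*-assoc _ _ _))
    originsWeight≈powers a b (right ∷ gs) =
      ≈-trans (*-congˡ (originsWeight≈powers a b gs))
              (≈-trans (x∙yz≈y∙xz _ _ _) (*-congˡ (≈-sym (*-assoc _ _ _))))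
    originsWeight≈powers a b (below ∷ gs) =
      ≈-trans (*-congˡ (originsWeight≈powers a b gs))
              (≈-trans (x∙yz≈y∙xz _ _ _) (*-congˡ (x∙yz≈y∙xz _ _ _)))

    Σ-words : ∀ a b k → Σ (map (originsWeight a b) (words k)) ≈ (t ⊕ (a ⊕ b)) ^ k
    Σ-words a b zero    = +-identityʳ 1#
    Σ-words a b (suc k) = begin
      Σ (map w (concatMap (λ g → map (g ∷_) W) origins))  ≈⟨ Σ-concatMap (λ g → map (g ∷_) W) w origins ⟩
      Σ (map (λ g → Σ (map w (map (g ∷_) W))) origins)
        ≈⟨ Σ-cong origins (λ {g} _ →
             ≈-trans (reflexive (Σ-map-∘ (g ∷_) w W)) (Σ-*ˡ (originValue a b g) W w)) ⟩
      t ⊗ S ⊕ (a ⊗ S ⊕ (b ⊗ S ⊕ 0#))                    ≈⟨ +-congˡ (+-congˡ (+-identityʳ _)) ⟩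
      t ⊗ S ⊕ (a ⊗ S ⊕ b ⊗ S)                           ≈⟨ +-congˡ (≈-sym (distribʳ S a b)) ⟩
      t ⊗ S ⊕ (a ⊕ b) ⊗ S                               ≈⟨ ≈-sym (distribʳ S t (a ⊕ b)) ⟩
      (t ⊕ (a ⊕ b)) ⊗ S                                 ≈⟨ *-congˡ (Σ-words a b k) ⟩
      (t ⊕ (a ⊕ b)) ^ suc k                             ∎
      where
      w : List Origin → Carrier
      w = originsWeight a b
      W : List (List Origin)
      W = words k
      S : Carrier
      S = Σ (map w W)

    contractedWeight : (ℕ → Carrier) → ℕ → Contracted → Carrier
    contractedWeight x μ (p , T′ , gs) = (x p ⊗ originsWeight (x p) (x μ) gs) ⊗ weight (update x μ 1#) T′

    weight-parent : ∀ x p μ L R D →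
      youngCh (L ++ node μ D ∷ R) ≡ suc (youngCh R) → elderCh (L ++ node μ D ∷ R) ≡ length L + elderCh R →
      weight x (node p (L ++ node μ D ∷ R)) ≈
        (x p ⊗ (t ^ youngCh L ⊗ (x p ^ youngCh R ⊗ x μ ^ youngCh D))) ⊗
        (t ^ elderParts (L , R , D) ⊗ (weights x L ⊗ (weights x R ⊗ weights x D)))
    weight-parent x p μ L R D youngCh≡ elderCh≡ = begin
      x p ^ youngCh cs ⊗ (t ^ elderCh cs ⊗ weights x cs)
        ≡⟨ cong₂ (λ m n → x p ^ m ⊗ (t ^ n ⊗ weights x cs))
                 youngCh≡ (trans elderCh≡ (cong (_+ elderCh R) (length≡youngCh+elderCh L))) ⟩
      x p ^ suc (youngCh R) ⊗ (t ^ ((youngCh L + elderCh L) + elderCh R) ⊗ weights x cs)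
        ≈⟨ *-congˡ (*-cong (≈-trans (^-homo-* t (youngCh L + elderCh L) (elderCh R))
                                    (*-congʳ (^-homo-* t (youngCh L) (elderCh L))))
                           (weights-++ x L (node μ D ∷ R))) ⟩
      (P ⊗ PR) ⊗ (((TL ⊗ TEL) ⊗ TER) ⊗ (WL ⊗ ((MD ⊗ (TED ⊗ WD)) ⊗ WR)))
        ≈⟨ *-Solver.solve 10 (λ P PR TL TEL TER MD TED WL WR WD →
             (P ∙ PR) ∙ (((TL ∙ TEL) ∙ TER) ∙ (WL ∙ ((MD ∙ (TED ∙ WD)) ∙ WR))) ⊜
             (P ∙ (TL ∙ (PR ∙ MD))) ∙ ((TEL ∙ (TER ∙ TED)) ∙ (WL ∙ (WR ∙ WD))))
             ≈-refl P PR TL TEL TER MD TED WL WR WD ⟩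
      (P ⊗ (TL ⊗ (PR ⊗ MD))) ⊗ ((TEL ⊗ (TER ⊗ TED)) ⊗ (WL ⊗ (WR ⊗ WD)))
        ≈⟨ *-congˡ (*-congʳ (≈-sym (≈-trans (^-homo-* t (elderCh L) _)
                                            (*-congˡ (^-homo-* t (elderCh R) (elderCh D)))))) ⟩
      (P ⊗ (TL ⊗ (PR ⊗ MD))) ⊗ (t ^ elderParts (L , R , D) ⊗ (WL ⊗ (WR ⊗ WD))) ∎
      where
      open *-Solver using (_⊜_) renaming (_⊕_ to _∙_)
      cs : List Tree
      cs = L ++ node μ D ∷ R
      P PR TL TEL TER MD TED WL WR WD : Carrier
      P   = x p
      PR  = x p ^ youngCh R
      TL  = t ^ youngCh L
      TEL = t ^ elderCh L
      TER = t ^ elderCh R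
      MD  = x μ ^ youngCh D
      TED = t ^ elderCh D
      WL  = weights x L
      WR  = weights x R
      WD  = weights x D

    weight-new-root : ∀ x μ E → μ ∉ labelsF E → weight (update x μ 1#) (node μ E) ≈ t ^ elderCh E ⊗ weights x E
    weight-new-root x μ E μ∉ = begin
      update x μ 1# μ ^ youngCh E ⊗ (t ^ elderCh E ⊗ weights (update x μ 1#) E)
        ≈⟨ *-cong (≈-trans (reflexive (cong (_^ youngCh E) (update-same x μ 1#))) (1^ (youngCh E)))
                  (*-congˡ (weights-update-∉ x μ 1# E μ∉)) ⟩
      1# ⊗ (t ^ elderCh E ⊗ weights x E) ≈⟨ *-identityˡ _ ⟩
      t ^ elderCh E ⊗ weights x E        ∎

    weight-contract-parent : ∀ x p μ L R D E gs →
      youngCh (L ++ node μ D ∷ R) ≡ suc (youngCh R) → elderCh (L ++ node μ D ∷ R) ≡ length L + elderCh R →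
      (∀ g → youngCh (part g (L , R , D)) ≡ count g gs) → elderParts (L , R , D) ≡ elderCh E →
      E ↭ L ++ R ++ D → μ ∉ labelsF E →
      weight x (node p (L ++ node μ D ∷ R)) ≈
      (x p ⊗ originsWeight (x p) (x μ) gs) ⊗ weight (update x μ 1#) (node μ E)
    weight-contract-parent x p μ L R D E gs youngCh≡ elderCh≡ counts elder≡ E↭ μ∉ = begin
      weight x (node p (L ++ node μ D ∷ R))
        ≈⟨ weight-parent x p μ L R D youngCh≡ elderCh≡ ⟩
      (x p ⊗ (t ^ youngCh L ⊗ (x p ^ youngCh R ⊗ x μ ^ youngCh D))) ⊗
      (t ^ elderParts (L , R , D) ⊗ (weights x L ⊗ (weights x R ⊗ weights x D)))
        ≈⟨ *-cong (*-congˡ (≈-sym origins≈)) (*-cong (reflexive (cong (t ^_) elder≡)) (≈-sym weights-E)) ⟩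
      (x p ⊗ originsWeight (x p) (x μ) gs) ⊗ (t ^ elderCh E ⊗ weights x E)
        ≈⟨ *-congˡ (≈-sym (weight-new-root x μ E μ∉)) ⟩
      (x p ⊗ originsWeight (x p) (x μ) gs) ⊗ weight (update x μ 1#) (node μ E) ∎
      where
      origins≈ : originsWeight (x p) (x μ) gs ≈ t ^ youngCh L ⊗ (x p ^ youngCh R ⊗ x μ ^ youngCh D)
      origins≈ = ≈-trans (originsWeight≈powers (x p) (x μ) gs)
        (reflexive (sym (cong₂ (λ a b → t ^ a ⊗ b) (counts left)
                               (cong₂ (λ a b → x p ^ a ⊗ x μ ^ b) (counts right) (counts below)))))
      weights-E : weights x E ≈ weights x L ⊗ (weights x R ⊗ weights x D)
      weights-E = ≈-trans (weights-↭ x E↭) (≈-trans (weights-++ x L (R ++ D)) (*-congˡ (weights-++ x R D)))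

    module _ {S : List ℕ} {r μ : ℕ} (S-unique : Unique S) (μ∈S : μ ∈ S) (μ≢r : μ ≢ r)
             (μ-min : ∀ {v} → v ∈ S → v ≢ r → μ ≤ v) where
      open SmallestNonRoot S-unique μ∈S μ≢r μ-min

      weight-contract : ∀ x {T} → IsTreeOn S r T → weight x T ≈ contractedWeight x μ (contract μ T)
      weight-contract x valid with around-smallest valid
      ... | around C p L R D = ≈-trans
        (weight-plug C x (update x μ 1#) (node p (L ++ node μ D ∷ R)) (node μ E) _ agree (≡[]-or C β-same)
          (weight-contract-parent x p μ L R D E gs youngCh-parent elderCh-parent
            (λ g → subst (λ P → youngCh (part g P) ≡ count g gs) unmerge≡
                         (unmerge-youngCh E gs E-distinct length≡ g))
            (subst (λ P → elderParts P ≡ elderCh E) unmerge≡ (unmerge-elderCh E gs E-distinct length≡))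
            E↭parts μ∉E))
        (reflexive (cong (contractedWeight x μ) (sym contract≡)))
        where
        open Contraction C p L R D valid
        open MergeOf merge-correct
        agree : ∀ {v} → v ∈ ctxLabels C → x v ≈ update x μ 1# v
        agree {v} v∈ = reflexive (sym (update-other x μ 1# v (λ v≡μ → μ∉C (subst (_∈ ctxLabels C) v≡μ v∈))))
        β-same : C ≢ [] → β (node p (L ++ node μ D ∷ R)) ≡ β (node μ E)
        β-same C≢[] = trans (β-parent C≢[]) (sym β-contracted)
        ≡[]-or : ∀ {B : Set} (C′ : Ctx) → (C′ ≢ [] → B) → C′ ≡ [] ⊎ B
        ≡[]-or []      _ = inj₁ refl
        ≡[]-or (_ ∷ _) b = inj₂ (b (λ ()))

    -- Summing the weights

    rhsOn : ℕ → List ℕ → ℕ → (ℕ → Carrier) → Carrier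
    rhsOn zero    S r x = 1#
    rhsOn (suc m) S r x = x r ⊗ Π (map (λ k → Σ (map x S) ⊕ k · t) (range m))

    WeightSum : ℕ → Set (c ⊔ ℓ)
    WeightSum m = ∀ {S r} → length S ≡ suc m → Unique S → r ∈ S → ∀ ts → Unique ts → Enumerates ts S r →
      ∀ x → Σ (map (weight x) ts) ≈ rhsOn m S r x

    Σ-weights-singleton : ∀ r ts → Unique ts → Enumerates ts [ r ] r → ∀ x → Σ (map (weight x) ts) ≈ 1#
    Σ-weights-singleton r ts ts-unique ts-enum x = begin
      Σ (map (weight x) ts)        ≈⟨ Σ-map-↭ (weight x) ts↭ ⟩
      weight x (node r []) ⊕ 0#    ≈⟨ +-identityʳ _ ⟩
      1# ⊗ (1# ⊗ 1#)               ≈⟨ ≈-trans (*-identityˡ _) (*-identityˡ _) ⟩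
      1#                           ∎
      where
      only-tree : ∀ T → IsTreeOn [ r ] r T → T ≡ node r []
      only-tree (node v cs) (root≡ , labels↭) with ↭-singleton-inv labels↭
      only-tree (node v [])                (refl , _) | refl = refl
      only-tree (node v (node w ds ∷ cs)) _          | ()
      ts↭ : ts ↭ [ node r [] ]
      ts↭ = unique∧set⇒↭ ts-unique ([] ∷ []) (λ {T} → mk⇔
        (λ T∈ → here (only-tree T (Equivalence.to (ts-enum T) T∈)))
        (λ { (here refl) → Equivalence.from (ts-enum (node r [])) (refl , ↭-refl) }))

    merged : (ℕ → Carrier) → ℕ → ℕ → Carrier
    merged x μ p = t ⊕ (x p ⊕ x μ)

    parentTerm : ℕ → List ℕ → ℕ → ℕ → (ℕ → Carrier) → ℕ → Carrier
    parentTerm m S r μ x p = x p ⊗ rhsOn m (delete p S) (newRoot r μ p) (update x μ (merged x μ p))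

    module Step (m : ℕ) {S : List ℕ} {r μ : ℕ} (length≡ : length S ≡ suc (suc m)) (S-unique : Unique S)
                (r∈S : r ∈ S) (μ∈S : μ ∈ S) (μ≢r : μ ≢ r)
                (μ-min : ∀ {v} → v ∈ S → v ≢ r → μ ≤ v) (IH : WeightSum m) where

      -- Summing over the origins turns each younger child of μ into a factor t + x p + x μ.
      Σ-withOrigins : ∀ x p T′ →
        Σ (map (contractedWeight x μ) (map (λ gs → p , T′ , gs) (words (young T′ μ)))) ≈
        x p ⊗ weight (update x μ (merged x μ p)) T′
      Σ-withOrigins x p T′ = begin
        Σ (map (contractedWeight x μ) (map (λ gs → p , T′ , gs) W))
          ≡⟨ Σ-map-∘ (λ gs → p , T′ , gs) (contractedWeight x μ) W ⟩
        Σ (map (λ gs → (x p ⊗ ω gs) ⊗ W₁) W) ≈⟨ Σ-cong W (λ _ → xy∙z≈xz∙y _ _ _) ⟩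
        Σ (map (λ gs → (x p ⊗ W₁) ⊗ ω gs) W) ≈⟨ Σ-*ˡ (x p ⊗ W₁) W ω ⟩
        (x p ⊗ W₁) ⊗ Σ (map ω W)             ≈⟨ *-congˡ (Σ-words (x p) (x μ) (young T′ μ)) ⟩
        (x p ⊗ W₁) ⊗ z ^ young T′ μ          ≈⟨ xy∙z≈x∙zy _ _ _ ⟩
        x p ⊗ (z ^ young T′ μ ⊗ W₁)          ≈⟨ *-congˡ (≈-sym (weight-update x μ z T′)) ⟩
        x p ⊗ weight (update x μ z) T′       ∎
        where
        z : Carrier
        z = merged x μ p
        ω : List Origin → Carrier
        ω = originsWeight (x p) (x μ)
        W : List (List Origin)
        W = words (young T′ μ)
        W₁ : Carrier
        W₁ = weight (update x μ 1#) T′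

      newRoot-∈ : ∀ {p} → p ∈ delete μ S → newRoot r μ p ∈ delete p S
      newRoot-∈ {p} p∈ with does (p ≟ r) | proof (p ≟ r)
      ... | true  | ofʸ refl = ∈-delete⁺ r∈S μ∈S μ≢r
      ... | false | ofⁿ p≢r  = ∈-delete⁺ (∈-delete⁻ μ∈S p∈) r∈S (≢-sym p≢r)

      Σ-weights-by-parent : ∀ ts → Unique ts → Enumerates ts S r → ∀ x →
        Σ (map (weight x) ts) ≈ Σ (map (parentTerm m S r μ x) (delete μ S))
      Σ-weights-by-parent ts ts-unique ts-enum x = begin
        Σ (map (weight x) ts)
          ≈⟨ Σ-cong ts (λ T∈ → weight-contract S-unique μ∈S μ≢r μ-min x (Equivalence.to (ts-enum _) T∈)) ⟩
        Σ (map (λ T → cw (contract μ T)) ts)          ≡⟨ sym (Σ-map-∘ (contract μ) cw ts) ⟩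
        Σ (map cw (map (contract μ) ts))              ≈⟨ Σ-map-↭ cw (contract-↭ ts-unique) ⟩
        Σ (map cw candidates)                         ≈⟨ Σ-concatMap overParent cw (delete μ S) ⟩
        Σ (map (λ p → Σ (map cw (overParent p))) (delete μ S))
          ≈⟨ Σ-cong (delete μ S) (λ {p} p∈ → begin
               Σ (map cw (overParent p))
                 ≈⟨ Σ-concatMap (withOrigins p) cw (subtrees p) ⟩
               Σ (map (λ T′ → Σ (map cw (withOrigins p T′))) (subtrees p))
                 ≈⟨ Σ-cong (subtrees p) (λ {T′} _ → Σ-withOrigins x p T′) ⟩
               Σ (map (λ T′ → x p ⊗ weight (update x μ (merged x μ p)) T′) (subtrees p))
                 ≈⟨ Σ-*ˡ (x p) (subtrees p) (weight (update x μ (merged x μ p))) ⟩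
               x p ⊗ Σ (map (weight (update x μ (merged x μ p))) (subtrees p))
                 ≈⟨ *-congˡ (IH (suc-injective (trans (length-delete (∈-delete⁻ μ∈S p∈)) length≡))
                                (Unique-delete⁺ (∈-delete⁻ μ∈S p∈) S-unique) (newRoot-∈ p∈)
                                (subtrees p) (deduplicate-! _≟ᵗ_ _) (subtrees-enumerates p∈)
                                (update x μ (merged x μ p))) ⟩
               parentTerm m S r μ x p ∎) ⟩
        Σ (map (parentTerm m S r μ x) (delete μ S)) ∎
        where
        open ContractedTrees S-unique μ∈S μ≢r μ-min ts ts-enum
        cw : Contracted → Carrier
        cw = contractedWeight x μ

    module Parents {S : List ℕ} {r μ : ℕ} (S-unique : Unique S) (r∈S : r ∈ S) (μ∈S : μ ∈ S) (μ≢r : μ ≢ r)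
                   (x : ℕ → Carrier) where
      open import Algebra.Solver.CommutativeMonoid +-commutativeMonoid as +-Solver
        using (_⊜_) renaming (_⊕_ to _∔_)

      X : Carrier
      X = Σ (map x S)

      others : List ℕ
      others = delete r (delete μ S)

      r∈ : r ∈ delete μ S
      r∈ = ∈-delete⁺ μ∈S r∈S (≢-sym μ≢r)

      parents↭ : delete μ S ↭ r ∷ others
      parents↭ = delete-↭ (delete μ S) r∈

      S↭ : S ↭ μ ∷ r ∷ others
      S↭ = ↭-trans (delete-↭ S μ∈S) (prep μ parents↭)

      Σ-update-delete : ∀ {p} → p ∈ delete μ S → Σ (map (update x μ (merged x μ p)) (delete p S)) ≈ X ⊕ t
      Σ-update-delete {p} p∈ = begin
        Σ (map (update x μ z) U)                  ≈⟨ Σ-map-↭ (update x μ z) (delete-↭ U μ∈U) ⟩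
        update x μ z μ ⊕ Σ (map (update x μ z) V) ≈⟨ +-cong (reflexive (update-same x μ z)) (Σ-cong V x-on-V) ⟩
        (t ⊕ (x p ⊕ x μ)) ⊕ Σ (map x V)
          ≈⟨ +-Solver.solve 4 (λ a b c d → (a ∔ (b ∔ c)) ∔ d ⊜ (b ∔ (c ∔ d)) ∔ a)
                              ≈-refl t (x p) (x μ) _ ⟩
        (x p ⊕ (x μ ⊕ Σ (map x V))) ⊕ t
          ≈⟨ +-congʳ (≈-sym (Σ-map-↭ x (↭-trans (delete-↭ S p∈S) (prep p (delete-↭ U μ∈U))))) ⟩
        X ⊕ t                                     ∎
        where
        z : Carrier
        z = merged x μ p
        p∈S : p ∈ S
        p∈S = ∈-delete⁻ μ∈S p∈
        U V : List ℕ
        U = delete p S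
        V = delete μ U
        μ∈U : μ ∈ U
        μ∈U = ∈-delete⁺ p∈S μ∈S (≢-sym (∈-delete⇒≢ μ∈S S-unique p∈))
        x-on-V : ∀ {v} → v ∈ V → update x μ z v ≈ x v
        x-on-V {v} v∈ = reflexive (update-other x μ z v (∈-delete⇒≢ μ∈U (Unique-delete⁺ p∈S S-unique) v∈))

      Σ-parents : ∀ m → length S ≡ suc (suc m) →
        Σ (map (parentTerm m S r μ x) (delete μ S)) ≈ rhsOn (suc m) S r x
      Σ-parents zero length≡ =
        ≈-trans (Σ-map-↭ _ parents↭)
                (only-r others (suc-injective (suc-injective (trans (sym (↭-length S↭)) length≡))))
        where
        only-r : ∀ qs → length qs ≡ 0 → Σ (map (parentTerm zero S r μ x) (r ∷ qs)) ≈ x r ⊗ 1#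
        only-r [] _ = +-identityʳ _
      Σ-parents (suc n) length≡ = begin
        Σ (map h (delete μ S))                  ≈⟨ Σ-map-↭ h parents↭ ⟩
        h r ⊕ Σ (map h others)
          ≈⟨ +-cong h-r (≈-trans (Σ-cong others h-other) (Σ-*ˡ (x r ⊗ Q) others x)) ⟩
        x r ⊗ (merged x μ r ⊗ Q) ⊕ (x r ⊗ Q) ⊗ Σ (map x others)
          ≈⟨ +-congʳ (x∙yz≈xz∙y (x r) _ Q) ⟩
        (x r ⊗ Q) ⊗ merged x μ r ⊕ (x r ⊗ Q) ⊗ Σ (map x others)
          ≈⟨ ≈-sym (distribˡ (x r ⊗ Q) _ _) ⟩
        (x r ⊗ Q) ⊗ (merged x μ r ⊕ Σ (map x others)) ≈⟨ *-congˡ total ⟩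
        (x r ⊗ Q) ⊗ (X ⊕ 1 · t)                  ≈⟨ xy∙z≈x∙zy (x r) Q _ ⟩
        x r ⊗ ((X ⊕ 1 · t) ⊗ Q)
          ≡⟨ cong (λ ks → x r ⊗ Π (map (λ k → X ⊕ k · t) ks)) (sym (range-suc n)) ⟩
        rhsOn (suc (suc n)) S r x               ∎
        where
        h : ℕ → Carrier
        h = parentTerm (suc n) S r μ x
        Q : Carrier
        Q = Π (map (λ k → X ⊕ k · t) (map suc (range n)))
        factors : ∀ {p} → p ∈ delete μ S →
          Π (map (λ k → Σ (map (update x μ (merged x μ p)) (delete p S)) ⊕ k · t) (range n)) ≈ Q
        factors p∈ =
          ≈-trans (Π-cong (range n) (λ {k} _ → ≈-trans (+-congʳ (Σ-update-delete p∈)) (+-assoc X t (k · t))))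
                  (reflexive (cong Π (map-∘ (range n))))
        h-r : h r ≈ x r ⊗ (merged x μ r ⊗ Q)
        h-r = *-congˡ (*-cong (reflexive (trans (cong (update x μ _) (newRoot-root r μ)) (update-same x μ _)))
                              (factors r∈))
        h-other : ∀ {q} → q ∈ others → h q ≈ (x r ⊗ Q) ⊗ x q
        h-other {q} q∈ =
          ≈-trans (*-congˡ (*-cong (reflexive (trans (cong (update x μ _) new-root) x-r)) (factors q∈′)))
                  (*-comm _ _)
          where
          q∈′ : q ∈ delete μ S
          q∈′ = ∈-delete⁻ r∈ q∈
          new-root : newRoot r μ q ≡ r
          new-root = newRoot-other r μ q (∈-delete⇒≢ r∈ (Unique-delete⁺ μ∈S S-unique) q∈)
          x-r : update x μ (merged x μ q) r ≡ x r
          x-r = update-other x μ _ r (≢-sym μ≢r)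
        total : merged x μ r ⊕ Σ (map x others) ≈ X ⊕ 1 · t
        total = ≈-trans (+-Solver.solve 4 (λ a b c d → (a ∔ (b ∔ c)) ∔ d ⊜ (c ∔ (b ∔ d)) ∔ a)
                                          ≈-refl t (x r) (x μ) _)
                        (+-cong (≈-sym (Σ-map-↭ x S↭)) (≈-sym (+-identityʳ t)))

    Σ-weights : ∀ m → WeightSum m
    Σ-weights zero    {s ∷ []} _ _ (here refl) = Σ-weights-singleton s
    Σ-weights (suc m) length≡ S-unique r∈S ts ts-unique ts-enum x with smallest-non-root m length≡ S-unique r∈S
    ... | μ , μ∈S , μ≢r , μ-min =
      ≈-trans (Step.Σ-weights-by-parent m length≡ S-unique r∈S μ∈S μ≢r μ-min (Σ-weights m)
                                         ts ts-unique ts-enum x)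
              (Parents.Σ-parents S-unique r∈S μ∈S μ≢r x m length≡)

    treeWeight≈weight : ∀ n x T → labels T ↭ range n → treeWeight 𝓡 n x t T ≈ weight x T
    treeWeight≈weight n x T labels↭ = monomial≈weight x (range n) (range-unique n) T (∈-resp-↭ labels↭)

theorem4p6 : ∀ {c ℓ} (R : CommutativeSemiring c ℓ) (n r : ℕ) → 2 ≤ n → 1 ≤ r → r ≤ n →
    (ts : List Tree) → Unique ts → (∀ T → (T ∈ ts) ⇔ IsPlaneTree n r T) →
    (x : ℕ → CommutativeSemiring.Carrier R) (t : CommutativeSemiring.Carrier R) →
    CommutativeSemiring._≈_ R (sumL R (map (treeWeight R n x t) ts)) (rhs R n r x t)
theorem4p6 R n@(suc (suc m)) r (s≤s (s≤s z≤n)) 1≤r r≤n ts ts-unique ts-enum x t =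
  ≈-trans (Σ-cong R ts (λ T∈ → treeWeight≈weight R t n x _ (proj₂ (Equivalence.to (ts-enum _) T∈))))
          (Σ-weights R t (suc m) (length-range n) (range-unique n) (∈-range 1≤r r≤n) ts ts-unique ts-enum x)
  where open CommutativeSemiring R using () renaming (trans to ≈-trans)
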